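{- Let $X$ be a simplicial complex, let $w:X\to\mathbb{R}_{>0}$, and let $0\le\ell<k\le\dim(X)$. Then for all $\sigma,\tau\in X(k)$, \[ \sum_{\substack{\eta\in X(\ell):\\ \sigma,\tau\in X_\eta(k)}} s_\eta(\sigma)s_\eta(\tau)\cdot(k+1)\cdot\big(\mathcal{L}^{+}_{\eta}\big)_{\sigma,\tau}=(k-\ell)\cdot\mathcal{L}^+_k(X;w)_{\sigma,\tau}+(\ell+1)\cdot R_k(X;w)_{\sigma,\tau}. \]
   Context: A simplicial complex $X$ on a finite vertex set $V$ is a family of subsets of $V$ closed under taking subsets (it contains $\emptyset$); $X(k)$ is the set of its $k$-dimensional faces (faces of size $k+1$), so $X(-1)=\{\emptyset\}$. Fix a linear order $<$ on $V$. For $\sigma\in X(k-1)$, $\tau\in X(k)$ with $\sigma\subset\tau$, let $(\tau:\sigma)=(-1)^{|\{v\in\tau:\,v<u\}|}$, where $u$ is the unique vertex of $\tau\setminus\sigma$. The boundary matrix $\partial_k(X)\in\mathbb{R}^{X(k-1)\times X(k)}$ has $(\sigma,\tau)$-entry $(\tau:\sigma)$ if $\sigma\subset\tau$ and $0$ otherwise. For $w:X\to\mathbb{R}_{>0}$, $W_k(X)$ is the diagonal matrix indexed by $X(k)$ with entries $w(\sigma)$. For $0\le k\le\dim X-1$, $\mathcal{L}^+_k(X;w)=W_k(X)^{ -1/2}\partial_{k+1}(X)W_{k+1}(X)\partial_{k+1}(X)^TW_k(X)^{ -1/2}$, and $\mathcal{L}^+_{\dim X}(X;w)=0$. For $\sigma\in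 X$, $N_X(\sigma)=\{v\in V\setminus\sigma:\,\sigma\cup\{v\}\in X\}$; $R_k(X;w)$ is the diagonal matrix indexed by $X(k)$ with $R_k(X;w)_{\sigma,\sigma}=\sum_{v\in N_X(\sigma)}\frac{w(\sigma\cup\{v\})}{w(\sigma)}$. The link of $\eta\in X$ is $\mathrm{lk}(X,\eta)=\{\tau\in X:\,\tau\cap\eta=\emptyset,\ \tau\cup\eta\in X\}$ (with the induced vertex order), with weights $w_\eta(\sigma)=w(\sigma\cup\eta)$. For $\eta\in X(\ell)$ let $X_\eta(k)=\{\sigma\in X(k):\,\eta\subset\sigma\}$, and for $\sigma\in X_\eta(k)$ let $s_\eta(\sigma)=\binom{k+1}{\ell+1}^{ -1/2}(-1)^{|\{(i,j):\,i\in\sigma\setminus\eta,\ j\in\eta,\ i>j\}|}$. When $X_\eta(k)\neq\emptyset$, the map $\sigma\mapsto\sigma\setminus\eta$ is a bijection $X_\eta(k)\to\mathrm{lk}(X,\eta)(k-\ell-1)$, and $\mathcal{L}^+_\eta\in\mathbb{R}^{X_\eta(k)\times X_\eta(k)}$ is defined by $(\mathcal{L}^+_\eta)_{\sigma,\tau}=\mathcal{L}^+_{k-\ell-1}(\mathrm{lk}(X,\eta);w_\eta)_{\sigma\setminus\eta,\tau\setminus\eta}$. -}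

module Defs where

open import Level using (Level; _⊔_) renaming (suc to lsuc)
open import Data.Bool using (Bool; true; false; _∧_; not; if_then_else_)
open import Data.Nat using (ℕ; zero; suc; _∸_; _≡ᵇ_; _<ᵇ_; _≤ᵇ_) renaming (_⊔_ to _⊔ℕ_)
open import Data.Nat.Combinatorics using (_C_)
open import Data.Fin using (Fin; toℕ)
open import Data.Fin.Subset using (Subset; _⊆_; _∪_; _∩_; _─_; ⁅_⁆; ∣_∣; ⊥)
open import Data.Fin.Subset.Properties using (_⊆?_)
open import Data.Vec using (Vec; []; _∷_; lookup)
open import Data.Vec.Properties using (≡-dec)
open import Data.List using (List; []; _∷_; _++_; map; filterᵇ; length; foldr; allFin; concatMap)
open import Data.Maybe using (Maybe; just; nothing)
open import Data.Product using (_×_; _,_)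
open import Relation.Nullary using (does)
open import Relation.Binary using (Rel; IsStrictTotalOrder)
open import Relation.Binary.PropositionalEquality using (_≡_)
open import Algebra.Bundles using (CommutativeRing)
import Data.Bool as B

-- The paper works over ℝ; we work over an arbitrary
-- ordered field in which positive elements have square roots
-- (ℝ is an instance).

record SqrtOrderedField (c ℓ₁ ℓ₂ : Level) : Set (lsuc (c ⊔ ℓ₁ ⊔ ℓ₂)) where
  field
    commutativeRing : CommutativeRing c ℓ₁
  open CommutativeRing commutativeRing public
  field
    _<ᶠ_               : Rel Carrier ℓ₂
    isStrictTotalOrder : IsStrictTotalOrder _≈_ _<ᶠ_
    +-monoˡ-<          : ∀ {x y} z → x <ᶠ y → (x + z) <ᶠ (y + z)
    *-pos              : ∀ {x y} → 0# <ᶠ x → 0# <ᶠ y → 0# <ᶠ (x * y)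
    0<1                : 0# <ᶠ 1#
    inv                : Carrier → Carrier
    inv-cong           : ∀ {x y} → x ≈ y → inv x ≈ inv y
    inv-rinv           : ∀ x → 0# <ᶠ x → (x * inv x) ≈ 1#
    sqrt               : Carrier → Carrier
    sqrt-cong          : ∀ {x y} → x ≈ y → sqrt x ≈ sqrt y
    sqrt-pos           : ∀ x → 0# <ᶠ x → 0# <ᶠ sqrt x
    sqrt-sq            : ∀ x → 0# <ᶠ x → (sqrt x * sqrt x) ≈ x

-- Simplicial complexes on the vertex set Fin n, ordered by the usual
-- order of Fin n.  Faces are subsets; the complex is given by a
-- (decidable) face predicate.

record SimplicialComplex (n : ℕ) : Set where
  field
    face        : Subset n → Bool
    empty-face  : face ⊥ ≡ true
    down-closed : ∀ σ τ → σ ⊆ τ → face τ ≡ true → face σ ≡ true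
open SimplicialComplex public

allSubsets : (n : ℕ) → List (Subset n)
allSubsets zero    = [] ∷ []
allSubsets (suc n) = map (false ∷_) (allSubsets n) ++ map (true ∷_) (allSubsets n)

-- X(k): faces of dimension k, i.e. of size k+1
faces : ∀ {n} → (Subset n → Bool) → ℕ → List (Subset n)
faces {n} X k = filterᵇ (λ σ → X σ ∧ (∣ σ ∣ ≡ᵇ suc k)) (allSubsets n)

dimPlusOne : ∀ {n} → (Subset n → Bool) → ℕ
dimPlusOne {n} X = foldr (λ σ m → (if X σ then ∣ σ ∣ else 0) ⊔ℕ m) 0 (allSubsets n)

least : ∀ {n} → Subset n → Maybe (Fin n)
least {n} σ with filterᵇ (lookup σ) (allFin n)
... | []    = nothing
... | v ∷ _ = just v

countBelow : ∀ {n} → Subset n → Fin n → ℕ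
countBelow {n} τ u = length (filterᵇ (λ v → lookup τ v ∧ (toℕ v <ᵇ toℕ u)) (allFin n))

isFacet : ∀ {n} → Subset n → Subset n → Bool
isFacet σ τ = does (σ ⊆? τ) ∧ (∣ τ ∣ ≡ᵇ suc ∣ σ ∣)

-- exponent in (τ : σ) = (-1)^{|{v ∈ τ : v < u}|}, u the vertex of τ ∖ σ
bdExp : ∀ {n} → Subset n → Subset n → ℕ
bdExp σ τ with least (τ ─ σ)
... | just u  = countBelow τ u
... | nothing = 0

pairCount : ∀ {n} → Subset n → Subset n → ℕ
pairCount {n} σ η =
  length (filterᵇ (λ p → pc p) (concatMap (λ i → map (λ j → (i , j)) (allFin n)) (allFin n)))
  where
  pc : Fin n × Fin n → Bool
  pc (i , j) = lookup (σ ─ η) i ∧ lookup η j ∧ (toℕ j <ᵇ toℕ i)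

link : ∀ {n} → (Subset n → Bool) → Subset n → (Subset n → Bool)
link X η ρ = (∣ ρ ∩ η ∣ ≡ᵇ 0) ∧ X (ρ ∪ η)

module Laplacians {c ℓ₁ ℓ₂} (F : SqrtOrderedField c ℓ₁ ℓ₂) where
  open SqrtOrderedField F

  sumL : ∀ {a} {A : Set a} → List A → (A → Carrier) → Carrier
  sumL xs f = foldr (λ x s → f x + s) 0# xs

  sign : ℕ → Carrier
  sign zero    = 1#
  sign (suc m) = - sign m

  ⟦_⟧ : ℕ → Carrier
  ⟦ zero ⟧  = 0#
  ⟦ suc m ⟧ = 1# + ⟦ m ⟧

  invSqrt : Carrier → Carrier
  invSqrt x = inv (sqrt x)

  bd : ∀ {n} → Subset n → Subset n → Carrier
  bd σ τ = if isFacet σ τ then sign (bdExp σ τ) else 0#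

  -- L^+_k(X;w)_{σ,τ} (zero when k = dim X)
  upLap : ∀ {n} → (Subset n → Bool) → (Subset n → Carrier) → ℕ → Subset n → Subset n → Carrier
  upLap X w k σ τ =
    if suc (suc k) ≤ᵇ dimPlusOne X
    then (invSqrt (w σ) * sumL (faces X (suc k)) (λ ρ → bd σ ρ * w ρ * bd τ ρ)) * invSqrt (w τ)
    else 0#

  Rmat : ∀ {n} → (Subset n → Bool) → (Subset n → Carrier) → Subset n → Subset n → Carrier
  Rmat {n} X w σ τ =
    if does (≡-dec B._≟_ σ τ)
    then sumL (filterᵇ (λ v → not (lookup σ v) ∧ X (σ ∪ ⁅ v ⁆)) (allFin n))
              (λ v → w (σ ∪ ⁅ v ⁆) * inv (w σ))
    else 0#

  sη : ∀ {n} → ℕ → ℕ → Subset n → Subset n → Carrier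
  sη k ℓ η σ = invSqrt ⟦ suc k C suc ℓ ⟧ * sign (pairCount σ η)

  Lη : ∀ {n} → (Subset n → Bool) → (Subset n → Carrier) → ℕ → ℕ → Subset n → Subset n → Subset n → Carrier
  Lη X w k ℓ η σ τ = upLap (link X η) (λ ρ → w (ρ ∪ η)) (k ∸ ℓ ∸ 1) (σ ─ η) (τ ─ η)

  lhs43 : ∀ {n} → (Subset n → Bool) → (Subset n → Carrier) → ℕ → ℕ → Subset n → Subset n → Carrier
  lhs43 X w k ℓ σ τ =
    sumL (filterᵇ (λ η → does (η ⊆? σ) ∧ does (η ⊆? τ)) (faces X ℓ))
         (λ η → sη k ℓ η σ * sη k ℓ η τ * ⟦ suc k ⟧ * Lη X w k ℓ η σ τ)

  rhs43 : ∀ {n} → (Subset n → Bool) → (Subset n → Carrier) → ℕ → ℕ → Subset n → Subset n → Carrier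
  rhs43 X w k ℓ σ τ = ⟦ k ∸ ℓ ⟧ * upLap X w k σ τ + ⟦ suc ℓ ⟧ * Rmat X w σ τ

{-# OPTIONS --safe #-}
module Submission where

-- Fix η ⊆ σ ∩ τ with |η| = ℓ + 1.  Removing η is a bijection from the (k+1)-faces of X containing η
-- onto the (k−ℓ)-faces of lk(X, η), it preserves weights, and it changes incidence numbers only by the
-- signs ε_η(ρ) = (−1)^|{(i,j) : i ∈ ρ ∖ η, j ∈ η, i > j}|, namely (ρ∖η : σ∖η) ε_η(σ) = (ρ : σ) ε_η(ρ).
-- Hence each term of the left-hand sum equals (k+1)/C(k+1,ℓ+1) · L⁺_k(X)_{στ}, and there are
-- C(|σ∩τ|, ℓ+1) terms.  For σ = τ this is (k+1) L⁺_{σσ} with L⁺_{σσ} = R_{σσ}; for |σ∩τ| = k it is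
-- (k−ℓ) L⁺_{στ} because (k+1) C(k,ℓ+1) = (k−ℓ) C(k+1,ℓ+1); otherwise σ and τ have no common coface
-- and both sides vanish.

open import Defs
open import Function using (_∘_; id)
open import Function.Bundles using (Equivalence)
open import Data.Empty using (⊥-elim)
open import Data.Product using (_×_; _,_)
import Data.Bool as Bool
open import Data.Bool using (Bool; true; false; _∧_; not; if_then_else_; T; T?)
open import Data.Bool.Properties using (∧-assoc; ∧-zeroʳ; ∧-identityʳ; T-≡)
open import Data.Nat as ℕ using (ℕ; zero; suc; _+_; _*_; _∸_; _≡ᵇ_; _<ᵇ_; _≤ᵇ_; _<_; _≤_; _⊔_; z≤n; s≤s)
import Data.Nat.Properties as ℕₚ
open import Data.Nat.Solver using (module +-*-Solver)
open import Data.Nat.Combinatorics using (_C_; nCk+nC[k+1]≡[n+1]C[k+1]; nC1≡n)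
open import Data.Fin as Fin using (Fin; toℕ)
open import Data.Fin.Subset using (Subset; ∣_∣; _⊆_; _∪_; _∩_; _─_; ⁅_⁆; outside; inside) renaming (⊥ to ∅)
open import Data.Fin.Subset.Properties using (_⊆?_; ⊆-refl; ⊆-trans; p⊆q⇒∣p∣≤∣q∣; ∩-comm; ∩-idem; ∪-identityʳ)
open import Data.Vec using ([]; _∷_; lookup)
open import Data.Vec.Properties using (∷-injectiveʳ; ≡-dec)
open import Data.List using (List; []; _∷_; _++_; map; filterᵇ; length; foldr; allFin; concatMap; head)
open import Data.List.Properties using (length-map; length-++; filter-++; map-tabulate; head-map)
open import Data.List.Membership.Propositional using (_∈_)
open import Data.List.Membership.Propositional.Properties using (∈-++⁺ˡ; ∈-++⁺ʳ; ∈-map⁺)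
open import Data.List.Relation.Unary.Any using (here; there)
open import Data.Maybe as Maybe using (Maybe; just; nothing; maybe)
open import Relation.Nullary using (Dec; does; yes; no)
open import Relation.Nullary.Decidable using (dec-true; dec-false)
open import Relation.Binary using (IsStrictTotalOrder)
open import Relation.Binary.PropositionalEquality using (_≡_; _≢_; refl; sym; trans; cong; cong₂; subst; module ≡-Reasoning)
import Algebra.Solver.Ring.NaturalCoefficients.Default
open import Algebra.Properties.CommutativeSemigroup ℕₚ.+-commutativeSemigroup using () renaming (interchange to +-interchange)

∧-true⁻ : ∀ {a b} → a ∧ b ≡ true → a ≡ true × b ≡ true
∧-true⁻ {true} {true} refl = refl , refl

≡ᵇ-true⇒≡ : ∀ {m n} → (m ≡ᵇ n) ≡ true → m ≡ n
≡ᵇ-true⇒≡ {m} {n} e = ℕₚ.≡ᵇ⇒≡ m n (Equivalence.from T-≡ e)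

≡⇒≡ᵇ-true : ∀ {m n} → m ≡ n → (m ≡ᵇ n) ≡ true
≡⇒≡ᵇ-true {m} {n} = dec-true (m ℕ.≟ n)

+-cancelʳ-≡ᵇ : ∀ h m n → (m + h ≡ᵇ n + h) ≡ (m ≡ᵇ n)
+-cancelʳ-≡ᵇ zero    m n rewrite ℕₚ.+-identityʳ m | ℕₚ.+-identityʳ n = refl
+-cancelʳ-≡ᵇ (suc h) m n rewrite ℕₚ.+-suc m h | ℕₚ.+-suc n h = +-cancelʳ-≡ᵇ h m n

-- Subsets

_≟ˢ_ : ∀ {n} (p q : Subset n) → Dec (p ≡ q)
_≟ˢ_ = ≡-dec Bool._≟_

_⊆ᵇ_ : ∀ {n} → Subset n → Subset n → Bool
p ⊆ᵇ q = does (p ⊆? q)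

⊆ᵇ⇒⊆ : ∀ {n} (p q : Subset n) → p ⊆ᵇ q ≡ true → p ⊆ q
⊆ᵇ⇒⊆ p q e with p ⊆? q
... | yes p⊆q = p⊆q

⊆ᵇ-refl : ∀ {n} (p : Subset n) → p ⊆ᵇ p ≡ true
⊆ᵇ-refl p = dec-true (p ⊆? p) ⊆-refl

⊆ᵇ-trans : ∀ {n} (p q r : Subset n) → p ⊆ᵇ q ≡ true → q ⊆ᵇ r ≡ true → p ⊆ᵇ r ≡ true
⊆ᵇ-trans p q r p⊆q q⊆r = dec-true (p ⊆? r) (⊆-trans (⊆ᵇ⇒⊆ p q p⊆q) (⊆ᵇ⇒⊆ q r q⊆r))

-- isFacet (outside ∷ p) (inside ∷ q) reduces to eqᵇ p q.
eqᵇ : ∀ {n} → Subset n → Subset n → Bool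
eqᵇ p q = (p ⊆ᵇ q) ∧ (∣ q ∣ ≡ᵇ ∣ p ∣)

eqᵇ-refl : ∀ {n} (p : Subset n) → eqᵇ p p ≡ true
eqᵇ-refl p rewrite ⊆ᵇ-refl p = ≡⇒≡ᵇ-true {∣ p ∣} refl

eqᵇ⇒≡ : ∀ {n} (p q : Subset n) → eqᵇ p q ≡ true → p ≡ q
eqᵇ⇒≡ []           []           _ = refl
eqᵇ⇒≡ (inside ∷ p)  (inside ∷ q)  e = cong (inside ∷_) (eqᵇ⇒≡ p q e)
eqᵇ⇒≡ (outside ∷ p) (outside ∷ q) e = cong (outside ∷_) (eqᵇ⇒≡ p q e)
eqᵇ⇒≡ (inside ∷ p)  (outside ∷ q) ()
eqᵇ⇒≡ (outside ∷ p) (inside ∷ q)  e with p⊆q , ∣q∣+1≡∣p∣ ← ∧-true⁻ {p ⊆ᵇ q} e =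
  ⊥-elim (ℕₚ.<⇒≢ (s≤s (p⊆q⇒∣p∣≤∣q∣ (⊆ᵇ⇒⊆ p q p⊆q))) (sym (≡ᵇ-true⇒≡ ∣q∣+1≡∣p∣)))

∣p─q∣+∣q∣≡∣p∣ : ∀ {n} (p q : Subset n) → q ⊆ᵇ p ≡ true → ∣ p ─ q ∣ + ∣ q ∣ ≡ ∣ p ∣
∣p─q∣+∣q∣≡∣p∣ []           []           _ = refl
∣p─q∣+∣q∣≡∣p∣ (inside ∷ p)  (inside ∷ q)  e = trans (ℕₚ.+-suc ∣ p ─ q ∣ ∣ q ∣) (cong suc (∣p─q∣+∣q∣≡∣p∣ p q e))
∣p─q∣+∣q∣≡∣p∣ (inside ∷ p)  (outside ∷ q) e = cong suc (∣p─q∣+∣q∣≡∣p∣ p q e)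
∣p─q∣+∣q∣≡∣p∣ (outside ∷ p) (outside ∷ q) e = ∣p─q∣+∣q∣≡∣p∣ p q e
∣p─q∣+∣q∣≡∣p∣ (outside ∷ p) (inside ∷ q)  ()

p─q∪q≡p : ∀ {n} (p q : Subset n) → q ⊆ᵇ p ≡ true → (p ─ q) ∪ q ≡ p
p─q∪q≡p []           []           _ = refl
p─q∪q≡p (inside ∷ p)  (inside ∷ q)  e = cong (inside ∷_) (p─q∪q≡p p q e)
p─q∪q≡p (inside ∷ p)  (outside ∷ q) e = cong (inside ∷_) (p─q∪q≡p p q e)
p─q∪q≡p (outside ∷ p) (outside ∷ q) e = cong (outside ∷_) (p─q∪q≡p p q e)
p─q∪q≡p (outside ∷ p) (inside ∷ q)  ()

⊆ᵇ⇒∩≡ : ∀ {n} (p q : Subset n) → p ⊆ᵇ q ≡ true → p ∩ q ≡ p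
⊆ᵇ⇒∩≡ []           []           _ = refl
⊆ᵇ⇒∩≡ (inside ∷ p)  (inside ∷ q)  e = cong (inside ∷_) (⊆ᵇ⇒∩≡ p q e)
⊆ᵇ⇒∩≡ (inside ∷ p)  (outside ∷ q) ()
⊆ᵇ⇒∩≡ (outside ∷ p) (b ∷ q)       e = cong (outside ∷_) (⊆ᵇ⇒∩≡ p q e)

⊆ᵇ-∩ : ∀ {n} (η σ τ : Subset n) → η ⊆ᵇ (σ ∩ τ) ≡ (η ⊆ᵇ σ) ∧ (η ⊆ᵇ τ)
⊆ᵇ-∩ []           []           []           = refl
⊆ᵇ-∩ (outside ∷ η) (_ ∷ σ)      (_ ∷ τ)      = ⊆ᵇ-∩ η σ τ
⊆ᵇ-∩ (inside ∷ η)  (inside ∷ σ)  (inside ∷ τ)  = ⊆ᵇ-∩ η σ τ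
⊆ᵇ-∩ (inside ∷ η)  (inside ∷ σ)  (outside ∷ τ) = sym (∧-zeroʳ _)
⊆ᵇ-∩ (inside ∷ η)  (outside ∷ σ) (_ ∷ τ)      = refl

─-⊆ᵇ-cancel : ∀ {n} (η σ ρ : Subset n) → η ⊆ᵇ σ ≡ true → η ⊆ᵇ ρ ≡ true → (σ ─ η) ⊆ᵇ (ρ ─ η) ≡ σ ⊆ᵇ ρ
─-⊆ᵇ-cancel []           []           []           _  _  = refl
─-⊆ᵇ-cancel (inside ∷ η)  (inside ∷ σ)  (inside ∷ ρ)  p  q  = ─-⊆ᵇ-cancel η σ ρ p q
─-⊆ᵇ-cancel (inside ∷ η)  (outside ∷ σ) _            ()
─-⊆ᵇ-cancel (inside ∷ η)  (inside ∷ σ)  (outside ∷ ρ) _  ()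
─-⊆ᵇ-cancel (outside ∷ η) (inside ∷ σ)  (inside ∷ ρ)  p  q  = ─-⊆ᵇ-cancel η σ ρ p q
─-⊆ᵇ-cancel (outside ∷ η) (inside ∷ σ)  (outside ∷ ρ) _  _  = refl
─-⊆ᵇ-cancel (outside ∷ η) (outside ∷ σ) (_ ∷ ρ)      p  q  = ─-⊆ᵇ-cancel η σ ρ p q

∣─∣-≡ᵇ : ∀ {n} (η ρ : Subset n) (j : ℕ) → η ⊆ᵇ ρ ≡ true → (∣ ρ ─ η ∣ ≡ᵇ j) ≡ (∣ ρ ∣ ≡ᵇ j + ∣ η ∣)
∣─∣-≡ᵇ η ρ j η⊆ρ = trans (sym (+-cancelʳ-≡ᵇ ∣ η ∣ ∣ ρ ─ η ∣ j)) (cong (_≡ᵇ j + ∣ η ∣) (∣p─q∣+∣q∣≡∣p∣ ρ η η⊆ρ))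

∣─∣-≡ᵇ-cancel : ∀ {n} (η σ ρ : Subset n) (j : ℕ) → η ⊆ᵇ σ ≡ true → η ⊆ᵇ ρ ≡ true →
                (∣ ρ ─ η ∣ ≡ᵇ j + ∣ σ ─ η ∣) ≡ (∣ ρ ∣ ≡ᵇ j + ∣ σ ∣)
∣─∣-≡ᵇ-cancel η σ ρ j η⊆σ η⊆ρ = trans (∣─∣-≡ᵇ η ρ (j + ∣ σ ─ η ∣) η⊆ρ)
  (cong (∣ ρ ∣ ≡ᵇ_) (trans (ℕₚ.+-assoc j _ _) (cong (j +_) (∣p─q∣+∣q∣≡∣p∣ σ η η⊆σ))))

isFacet-─-cancel : ∀ {n} (η σ ρ : Subset n) → η ⊆ᵇ σ ≡ true → η ⊆ᵇ ρ ≡ true →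
                   isFacet (σ ─ η) (ρ ─ η) ≡ isFacet σ ρ
isFacet-─-cancel η σ ρ η⊆σ η⊆ρ = cong₂ _∧_ (─-⊆ᵇ-cancel η σ ρ η⊆σ η⊆ρ) (∣─∣-≡ᵇ-cancel η σ ρ 1 η⊆σ η⊆ρ)

eqᵇ-─-cancel : ∀ {n} (η σ ρ : Subset n) → η ⊆ᵇ σ ≡ true → η ⊆ᵇ ρ ≡ true → eqᵇ (σ ─ η) (ρ ─ η) ≡ eqᵇ σ ρ
eqᵇ-─-cancel η σ ρ η⊆σ η⊆ρ = cong₂ _∧_ (─-⊆ᵇ-cancel η σ ρ η⊆σ η⊆ρ) (∣─∣-≡ᵇ-cancel η σ ρ 0 η⊆σ η⊆ρ)

isFacet⇒⊆ᵇ : ∀ {n} (σ ρ : Subset n) → isFacet σ ρ ≡ true → σ ⊆ᵇ ρ ≡ true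
isFacet⇒⊆ᵇ σ ρ e with σ⊆ρ , _ ← ∧-true⁻ {σ ⊆ᵇ ρ} e = σ⊆ρ

isFacet⇒∣∣≡suc : ∀ {n} (σ ρ : Subset n) → isFacet σ ρ ≡ true → ∣ ρ ∣ ≡ suc ∣ σ ∣
isFacet⇒∣∣≡suc σ ρ e with _ , size ← ∧-true⁻ {σ ⊆ᵇ ρ} e = ≡ᵇ-true⇒≡ size

distinct-facets-∣∩∣ : ∀ {n} (σ τ ρ : Subset n) → isFacet σ ρ ≡ true → isFacet τ ρ ≡ true → σ ≢ τ →
                      suc ∣ σ ∩ τ ∣ ≡ ∣ σ ∣
distinct-facets-∣∩∣ [] [] [] _ _ σ≢τ = ⊥-elim (σ≢τ refl)
distinct-facets-∣∩∣ (inside ∷ σ) _ (outside ∷ ρ) ()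
distinct-facets-∣∩∣ (outside ∷ σ) (inside ∷ τ) (outside ∷ ρ) _ ()
distinct-facets-∣∩∣ (outside ∷ σ) (outside ∷ τ) (outside ∷ ρ) p q σ≢τ =
  distinct-facets-∣∩∣ σ τ ρ p q (σ≢τ ∘ cong (outside ∷_))
distinct-facets-∣∩∣ (inside ∷ σ) (inside ∷ τ) (inside ∷ ρ) p q σ≢τ =
  cong suc (distinct-facets-∣∩∣ σ τ ρ p q (σ≢τ ∘ cong (inside ∷_)))
distinct-facets-∣∩∣ (inside ∷ σ) (outside ∷ τ) (inside ∷ ρ) p q _
  rewrite eqᵇ⇒≡ τ ρ q | ⊆ᵇ⇒∩≡ σ ρ (isFacet⇒⊆ᵇ σ ρ p) = refl
distinct-facets-∣∩∣ (outside ∷ σ) (inside ∷ τ) (inside ∷ ρ) p q _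
  rewrite eqᵇ⇒≡ σ ρ p | ∩-comm ρ τ | ⊆ᵇ⇒∩≡ τ ρ (isFacet⇒⊆ᵇ τ ρ q) = sym (isFacet⇒∣∣≡suc τ ρ q)
distinct-facets-∣∩∣ (outside ∷ σ) (outside ∷ τ) (inside ∷ ρ) p q σ≢τ =
  ⊥-elim (σ≢τ (cong (outside ∷_) (trans (eqᵇ⇒≡ σ ρ p) (sym (eqᵇ⇒≡ τ ρ q)))))

-- Counting

𝕀 : Bool → ℕ
𝕀 true  = 1
𝕀 false = 0

countᵇ : ∀ {a} {A : Set a} → (A → Bool) → List A → ℕ
countᵇ p xs = length (filterᵇ p xs)

Σℕ : ∀ {a} {A : Set a} → List A → (A → ℕ) → ℕ
Σℕ xs f = foldr (λ x s → f x + s) 0 xs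

allFin-suc : ∀ n → allFin (suc n) ≡ Fin.zero ∷ map Fin.suc (allFin n)
allFin-suc n = cong (Fin.zero ∷_) (sym (map-tabulate id Fin.suc))

filterᵇ-map : ∀ {a b} {A : Set a} {B : Set b} (p : B → Bool) (f : A → B) (xs : List A) →
              filterᵇ p (map f xs) ≡ map f (filterᵇ (p ∘ f) xs)
filterᵇ-map p f []       = refl
filterᵇ-map p f (x ∷ xs) with p (f x)
... | true  = cong (f x ∷_) (filterᵇ-map p f xs)
... | false = filterᵇ-map p f xs

countᵇ-∷ : ∀ {a} {A : Set a} (p : A → Bool) x xs → countᵇ p (x ∷ xs) ≡ 𝕀 (p x) + countᵇ p xs
countᵇ-∷ p x xs with p x
... | true  = refl
... | false = refl

countᵇ-++ : ∀ {a} {A : Set a} (p : A → Bool) (xs ys : List A) → countᵇ p (xs ++ ys) ≡ countᵇ p xs + countᵇ p ys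
countᵇ-++ p xs ys = trans (cong length (filter-++ (T? ∘ p) xs ys)) (length-++ (filterᵇ p xs))

countᵇ-concatMap : ∀ {a b} {A : Set a} {B : Set b} (p : B → Bool) (g : A → List B) (xs : List A) →
                   countᵇ p (concatMap g xs) ≡ Σℕ xs (countᵇ p ∘ g)
countᵇ-concatMap p g []       = refl
countᵇ-concatMap p g (x ∷ xs) = trans (countᵇ-++ p (g x) (concatMap g xs)) (cong (countᵇ p (g x) +_) (countᵇ-concatMap p g xs))

countᵇ-map : ∀ {a b} {A : Set a} {B : Set b} (p : B → Bool) (f : A → B) (xs : List A) →
             countᵇ p (map f xs) ≡ countᵇ (p ∘ f) xs
countᵇ-map p f xs = trans (cong length (filterᵇ-map p f xs)) (length-map f (filterᵇ (p ∘ f) xs))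

countᵇ-allFin-suc : ∀ n (p : Fin (suc n) → Bool) →
                    countᵇ p (allFin (suc n)) ≡ 𝕀 (p Fin.zero) + countᵇ (p ∘ Fin.suc) (allFin n)
countᵇ-allFin-suc n p = begin
  countᵇ p (allFin (suc n))                               ≡⟨ cong (countᵇ p) (allFin-suc n) ⟩
  countᵇ p (Fin.zero ∷ map Fin.suc (allFin n))            ≡⟨ countᵇ-∷ p Fin.zero _ ⟩
  𝕀 (p Fin.zero) + countᵇ p (map Fin.suc (allFin n))      ≡⟨ cong (𝕀 (p Fin.zero) +_) (countᵇ-map p Fin.suc (allFin n)) ⟩
  𝕀 (p Fin.zero) + countᵇ (p ∘ Fin.suc) (allFin n)        ∎
  where open ≡-Reasoning

countᵇ-none : ∀ {a} {A : Set a} (p : A → Bool) (xs : List A) → (∀ x → p x ≡ false) → countᵇ p xs ≡ 0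
countᵇ-none p []       _    = refl
countᵇ-none p (x ∷ xs) none rewrite countᵇ-∷ p x xs | none x = countᵇ-none p xs none

Σℕ-cong : ∀ {a} {A : Set a} (xs : List A) {f g : A → ℕ} → (∀ x → f x ≡ g x) → Σℕ xs f ≡ Σℕ xs g
Σℕ-cong []       _   = refl
Σℕ-cong (x ∷ xs) f≗g = cong₂ _+_ (f≗g x) (Σℕ-cong xs f≗g)

Σℕ-+ : ∀ {a} {A : Set a} (xs : List A) (f g : A → ℕ) → Σℕ xs (λ x → f x + g x) ≡ Σℕ xs f + Σℕ xs g
Σℕ-+ []       f g = refl
Σℕ-+ (x ∷ xs) f g rewrite Σℕ-+ xs f g = +-interchange (f x) (g x) (Σℕ xs f) (Σℕ xs g)

Σℕ-allFin-suc : ∀ n (f : Fin (suc n) → ℕ) → Σℕ (allFin (suc n)) f ≡ f Fin.zero + Σℕ (allFin n) (f ∘ Fin.suc)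
Σℕ-allFin-suc n f = trans (cong (λ xs → Σℕ xs f) (allFin-suc n)) (cong (f Fin.zero +_) (Σℕ-map (allFin n)))
  where
  Σℕ-map : ∀ xs → Σℕ (map Fin.suc xs) f ≡ Σℕ xs (f ∘ Fin.suc)
  Σℕ-map []       = refl
  Σℕ-map (x ∷ xs) = cong (f (Fin.suc x) +_) (Σℕ-map xs)

Σℕ-𝕀-∧ : ∀ {n} (s : Subset n) (e : Bool) → Σℕ (allFin n) (λ i → 𝕀 (lookup s i ∧ e)) ≡ (if e then ∣ s ∣ else 0)
Σℕ-𝕀-∧ []                 true  = refl
Σℕ-𝕀-∧ []                 false = refl
Σℕ-𝕀-∧ {suc n} (inside ∷ s)  true  = trans (Σℕ-allFin-suc n (λ i → 𝕀 (lookup (inside ∷ s) i ∧ true))) (cong suc (Σℕ-𝕀-∧ s true))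
Σℕ-𝕀-∧ {suc n} (outside ∷ s) true  = trans (Σℕ-allFin-suc n (λ i → 𝕀 (lookup (outside ∷ s) i ∧ true))) (Σℕ-𝕀-∧ s true)
Σℕ-𝕀-∧ {suc n} (b ∷ s)       false = trans (Σℕ-allFin-suc n (λ i → 𝕀 (lookup (b ∷ s) i ∧ false)))
                                              (cong₂ _+_ (cong 𝕀 (∧-zeroʳ b)) (Σℕ-𝕀-∧ s false))

least≡head : ∀ {n} (s : Subset n) → least s ≡ head (filterᵇ (lookup s) (allFin n))
least≡head {n} s with filterᵇ (lookup s) (allFin n)
... | []    = refl
... | _ ∷ _ = refl

least-inside : ∀ {n} (s : Subset n) → least (inside ∷ s) ≡ just Fin.zero
least-inside {n} s = trans (least≡head (inside ∷ s)) (cong (head ∘ filterᵇ (lookup (inside ∷ s))) (allFin-suc n))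

least-outside : ∀ {n} (s : Subset n) → least (outside ∷ s) ≡ Maybe.map Fin.suc (least s)
least-outside {n} s = begin
  least (outside ∷ s)                                              ≡⟨ least≡head (outside ∷ s) ⟩
  head (filterᵇ (lookup (outside ∷ s)) (allFin (suc n)))           ≡⟨ cong (head ∘ filterᵇ (lookup (outside ∷ s))) (allFin-suc n) ⟩
  head (filterᵇ (lookup (outside ∷ s)) (map Fin.suc (allFin n)))   ≡⟨ cong head (filterᵇ-map (lookup (outside ∷ s)) Fin.suc (allFin n)) ⟩
  head (map Fin.suc (filterᵇ (lookup s) (allFin n)))               ≡⟨ head-map _ ⟩
  Maybe.map Fin.suc (head (filterᵇ (lookup s) (allFin n)))         ≡⟨ cong (Maybe.map Fin.suc) (least≡head s) ⟨
  Maybe.map Fin.suc (least s)                                      ∎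
  where open ≡-Reasoning

least≡nothing⇒∣∣≡0 : ∀ {n} (s : Subset n) → least s ≡ nothing → ∣ s ∣ ≡ 0
least≡nothing⇒∣∣≡0 []            _ = refl
least≡nothing⇒∣∣≡0 (inside ∷ s)  e with () ← trans (sym (least-inside s)) e
least≡nothing⇒∣∣≡0 (outside ∷ s) e = least≡nothing⇒∣∣≡0 s (map-nothing (least s) (trans (sym (least-outside s)) e))
  where
  map-nothing : ∀ {n} (m : Maybe (Fin n)) → Maybe.map Fin.suc m ≡ nothing → m ≡ nothing
  map-nothing nothing _ = refl

isBelow : ∀ {n} → Subset n → Fin n → Fin n → Bool
isBelow s u v = lookup s v ∧ (toℕ v <ᵇ toℕ u)

countBelow-zero : ∀ {n} (b : Bool) (s : Subset n) → countBelow (b ∷ s) Fin.zero ≡ 0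
countBelow-zero {n} b s = trans (countᵇ-allFin-suc n (isBelow (b ∷ s) Fin.zero))
  (cong₂ _+_ (cong 𝕀 (∧-zeroʳ b)) (countᵇ-none _ (allFin n) (λ v → ∧-zeroʳ (lookup s v))))

countBelow-suc : ∀ {n} (b : Bool) (s : Subset n) (u : Fin n) → countBelow (b ∷ s) (Fin.suc u) ≡ 𝕀 b + countBelow s u
countBelow-suc {n} b s u = trans (countᵇ-allFin-suc n (isBelow (b ∷ s) (Fin.suc u))) (cong (λ x → 𝕀 x + countBelow s u) (∧-identityʳ b))

bdExp≡ : ∀ {n} (σ ρ : Subset n) → bdExp σ ρ ≡ maybe (countBelow ρ) 0 (least (ρ ─ σ))
bdExp≡ σ ρ with least (ρ ─ σ)
... | just _  = refl
... | nothing = refl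

bdExp-outside-outside : ∀ {n} (σ ρ : Subset n) → bdExp (outside ∷ σ) (outside ∷ ρ) ≡ bdExp σ ρ
bdExp-outside-outside σ ρ = begin
  bdExp (outside ∷ σ) (outside ∷ ρ)                                  ≡⟨ bdExp≡ (outside ∷ σ) (outside ∷ ρ) ⟩
  maybe (countBelow (outside ∷ ρ)) 0 (least (outside ∷ (ρ ─ σ)))     ≡⟨ cong (maybe (countBelow (outside ∷ ρ)) 0) (least-outside (ρ ─ σ)) ⟩
  maybe (countBelow (outside ∷ ρ)) 0 (Maybe.map Fin.suc (least (ρ ─ σ))) ≡⟨ shift (least (ρ ─ σ)) ⟩
  maybe (countBelow ρ) 0 (least (ρ ─ σ))                             ≡⟨ bdExp≡ σ ρ ⟨
  bdExp σ ρ                                                          ∎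
  where
  open ≡-Reasoning
  shift : ∀ m → maybe (countBelow (outside ∷ ρ)) 0 (Maybe.map Fin.suc m) ≡ maybe (countBelow ρ) 0 m
  shift (just u) = countBelow-suc outside ρ u
  shift nothing  = refl

bdExp-inside-inside : ∀ {n} (σ ρ : Subset n) → isFacet σ ρ ≡ true → bdExp (inside ∷ σ) (inside ∷ ρ) ≡ suc (bdExp σ ρ)
bdExp-inside-inside σ ρ σ⋖ρ = begin
  bdExp (inside ∷ σ) (inside ∷ ρ)                                   ≡⟨ bdExp≡ (inside ∷ σ) (inside ∷ ρ) ⟩
  maybe (countBelow (inside ∷ ρ)) 0 (least (outside ∷ (ρ ─ σ)))     ≡⟨ cong (maybe (countBelow (inside ∷ ρ)) 0) (least-outside (ρ ─ σ)) ⟩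
  maybe (countBelow (inside ∷ ρ)) 0 (Maybe.map Fin.suc (least (ρ ─ σ))) ≡⟨ shift (least (ρ ─ σ)) refl ⟩
  suc (maybe (countBelow ρ) 0 (least (ρ ─ σ)))                      ≡⟨ cong suc (bdExp≡ σ ρ) ⟨
  suc (bdExp σ ρ)                                                   ∎
  where
  open ≡-Reasoning
  ρ─σ≢∅ : ∣ ρ ─ σ ∣ ≢ 0
  ρ─σ≢∅ e = ℕₚ.1+n≢n (trans (sym (isFacet⇒∣∣≡suc σ ρ σ⋖ρ))
    (trans (sym (∣p─q∣+∣q∣≡∣p∣ ρ σ (isFacet⇒⊆ᵇ σ ρ σ⋖ρ))) (cong (_+ ∣ σ ∣) e)))
  shift : ∀ m → least (ρ ─ σ) ≡ m → maybe (countBelow (inside ∷ ρ)) 0 (Maybe.map Fin.suc m) ≡ suc (maybe (countBelow ρ) 0 m)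
  shift (just u) _ = countBelow-suc inside ρ u
  shift nothing  e = ⊥-elim (ρ─σ≢∅ (least≡nothing⇒∣∣≡0 (ρ ─ σ) e))

bdExp-outside-inside : ∀ {n} (σ ρ : Subset n) → bdExp (outside ∷ σ) (inside ∷ ρ) ≡ 0
bdExp-outside-inside σ ρ = trans (bdExp≡ (outside ∷ σ) (inside ∷ ρ))
  (trans (cong (maybe (countBelow (inside ∷ ρ)) 0) (least-inside (ρ ─ σ))) (countBelow-zero inside ρ))

isPair : ∀ {n} → Subset n → Subset n → Fin n → Fin n → Bool
isPair σ η i j = lookup (σ ─ η) i ∧ lookup η j ∧ (toℕ j <ᵇ toℕ i)

pairsAbove : ∀ {n} → Subset n → Subset n → Fin n → ℕ
pairsAbove {n} σ η i = countᵇ (isPair σ η i) (allFin n)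

pairCount≡Σℕ : ∀ {n} (σ η : Subset n) → pairCount σ η ≡ Σℕ (allFin n) (pairsAbove σ η)
pairCount≡Σℕ {n} σ η = trans (countᵇ-concatMap _ (λ i → map (i ,_) (allFin n)) (allFin n))
  (Σℕ-cong (allFin n) (λ i → countᵇ-map _ (i ,_) (allFin n)))

pairCount-∷ : ∀ {n} (b e : Bool) (σ η : Subset n) →
              pairCount (b ∷ σ) (e ∷ η) ≡ (if e then ∣ σ ─ η ∣ else 0) + pairCount σ η
pairCount-∷ {n} b e σ η = begin
  pairCount (b ∷ σ) (e ∷ η)                                                   ≡⟨ pairCount≡Σℕ (b ∷ σ) (e ∷ η) ⟩
  Σℕ (allFin (suc n)) (pairsAbove (b ∷ σ) (e ∷ η))                            ≡⟨ Σℕ-allFin-suc n (pairsAbove (b ∷ σ) (e ∷ η)) ⟩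
  pairsAbove (b ∷ σ) (e ∷ η) Fin.zero + Σℕ (allFin n) (pairsAbove (b ∷ σ) (e ∷ η) ∘ Fin.suc)
    ≡⟨ cong₂ _+_ first-zero (Σℕ-cong (allFin n) first-suc) ⟩
  Σℕ (allFin n) (λ i → 𝕀 (lookup (σ ─ η) i ∧ e) + pairsAbove σ η i)
    ≡⟨ Σℕ-+ (allFin n) (λ i → 𝕀 (lookup (σ ─ η) i ∧ e)) (pairsAbove σ η) ⟩
  Σℕ (allFin n) (λ i → 𝕀 (lookup (σ ─ η) i ∧ e)) + Σℕ (allFin n) (pairsAbove σ η)
    ≡⟨ cong₂ _+_ (Σℕ-𝕀-∧ (σ ─ η) e) (sym (pairCount≡Σℕ σ η)) ⟩
  (if e then ∣ σ ─ η ∣ else 0) + pairCount σ η                                ∎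
  where
  open ≡-Reasoning
  first-zero : pairsAbove (b ∷ σ) (e ∷ η) Fin.zero ≡ 0
  first-zero = countᵇ-none (isPair (b ∷ σ) (e ∷ η) Fin.zero) (allFin (suc n))
    (λ j → trans (cong (lookup ((b ∷ σ) ─ (e ∷ η)) Fin.zero ∧_) (∧-zeroʳ (lookup (e ∷ η) j))) (∧-zeroʳ _))
  first-suc : ∀ i → pairsAbove (b ∷ σ) (e ∷ η) (Fin.suc i) ≡ 𝕀 (lookup (σ ─ η) i ∧ e) + pairsAbove σ η i
  first-suc i = trans (countᵇ-allFin-suc n (isPair (b ∷ σ) (e ∷ η) (Fin.suc i)))
                      (cong (λ x → 𝕀 (lookup (σ ─ η) i ∧ x) + pairsAbove σ η i) (∧-identityʳ e))

∈-allSubsets : ∀ {n} (ρ : Subset n) → ρ ∈ allSubsets n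
∈-allSubsets []                    = here refl
∈-allSubsets {suc n} (outside ∷ ρ) = ∈-++⁺ˡ (∈-map⁺ (outside ∷_) (∈-allSubsets ρ))
∈-allSubsets {suc n} (inside ∷ ρ)  = ∈-++⁺ʳ (map (outside ∷_) (allSubsets n)) (∈-map⁺ (inside ∷_) (∈-allSubsets ρ))

face⇒∣∣≤dimPlusOne : ∀ {n} (X : Subset n → Bool) (ρ : Subset n) → X ρ ≡ true → ∣ ρ ∣ ≤ dimPlusOne X
face⇒∣∣≤dimPlusOne {n} X ρ ρ∈X = ≤-fold (∈-allSubsets ρ)
  where
  ≤-fold : ∀ {σs} → ρ ∈ σs → ∣ ρ ∣ ≤ foldr (λ σ m → (if X σ then ∣ σ ∣ else 0) ⊔ m) 0 σs
  ≤-fold (here refl) rewrite ρ∈X = ℕₚ.m≤m⊔n ∣ ρ ∣ _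
  ≤-fold (there p)              = ℕₚ.≤-trans (≤-fold p) (ℕₚ.m≤n⊔m _ _)

-- Binomial coefficients

[1+k]*[1+n]C[1+k]≡[1+n]*nCk : ∀ n k → suc k * (suc n C suc k) ≡ suc n * (n C k)
[1+k]*[1+n]C[1+k]≡[1+n]*nCk zero    zero    = refl
[1+k]*[1+n]C[1+k]≡[1+n]*nCk zero    (suc k) = ℕₚ.*-zeroʳ (suc (suc k))
[1+k]*[1+n]C[1+k]≡[1+n]*nCk (suc n) zero    =
  trans (ℕₚ.+-identityʳ _) (trans (nC1≡n (suc (suc n))) (sym (ℕₚ.*-identityʳ (suc (suc n)))))
[1+k]*[1+n]C[1+k]≡[1+n]*nCk (suc n) (suc k) = begin
  suc (suc k) * (suc (suc n) C suc (suc k))  ≡⟨ cong (suc (suc k) *_) (nCk+nC[k+1]≡[n+1]C[k+1] (suc n) (suc k)) ⟨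
  suc (suc k) * (a + b)                      ≡⟨ distribute k a b ⟩
  a + (suc k * a + suc (suc k) * b)
    ≡⟨ cong (a +_) (cong₂ _+_ ([1+k]*[1+n]C[1+k]≡[1+n]*nCk n k) ([1+k]*[1+n]C[1+k]≡[1+n]*nCk n (suc k))) ⟩
  a + (suc n * (n C k) + suc n * (n C suc k)) ≡⟨ cong (a +_) (ℕₚ.*-distribˡ-+ (suc n) (n C k) (n C suc k)) ⟨
  a + suc n * (n C k + n C suc k)            ≡⟨ cong (λ x → a + suc n * x) (nCk+nC[k+1]≡[n+1]C[k+1] n k) ⟩
  suc (suc n) * a                            ∎
  where
  open ≡-Reasoning
  a = suc n C suc k
  b = suc n C suc (suc k)
  distribute : ∀ k a b → suc (suc k) * (a + b) ≡ a + (suc k * a + suc (suc k) * b)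
  distribute = solve 3 (λ k a b → (con 2 :+ k) :* (a :+ b) := a :+ ((con 1 :+ k) :* a :+ (con 2 :+ k) :* b)) refl
    where open +-*-Solver

[1+k]*nC[1+k]≡[n∸k]*nCk : ∀ n k → k ≤ n → suc k * (n C suc k) ≡ (n ∸ k) * (n C k)
[1+k]*nC[1+k]≡[n∸k]*nCk n k k≤n = ℕₚ.+-cancelˡ-≡ (suc k * (n C k)) _ _ (begin
  suc k * (n C k) + suc k * (n C suc k)  ≡⟨ ℕₚ.*-distribˡ-+ (suc k) (n C k) (n C suc k) ⟨
  suc k * (n C k + n C suc k)            ≡⟨ cong (suc k *_) (nCk+nC[k+1]≡[n+1]C[k+1] n k) ⟩
  suc k * (suc n C suc k)                ≡⟨ [1+k]*[1+n]C[1+k]≡[1+n]*nCk n k ⟩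
  suc n * (n C k)                        ≡⟨ cong (_* (n C k)) n∸k+[1+k]≡1+n ⟨
  (n ∸ k + suc k) * (n C k)              ≡⟨ ℕₚ.*-distribʳ-+ (n C k) (n ∸ k) (suc k) ⟩
  (n ∸ k) * (n C k) + suc k * (n C k)    ≡⟨ ℕₚ.+-comm ((n ∸ k) * (n C k)) (suc k * (n C k)) ⟩
  suc k * (n C k) + (n ∸ k) * (n C k)    ∎)
  where
  open ≡-Reasoning
  n∸k+[1+k]≡1+n : n ∸ k + suc k ≡ suc n
  n∸k+[1+k]≡1+n = trans (ℕₚ.+-suc (n ∸ k) k) (cong suc (ℕₚ.m∸n+n≡m k≤n))

[1+n]*nC[1+k]≡[n∸k]*[1+n]C[1+k] : ∀ n k → k ≤ n → suc n * (n C suc k) ≡ (n ∸ k) * (suc n C suc k)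
[1+n]*nC[1+k]≡[n∸k]*[1+n]C[1+k] n k k≤n =
  trans (sym ([1+k]*[1+n]C[1+k]≡[1+n]*nCk n (suc k))) ([1+k]*nC[1+k]≡[n∸k]*nCk (suc n) (suc k) (s≤s k≤n))

nCk>0 : ∀ n k → k ≤ n → 0 < n C k
nCk>0 n       zero    _         = s≤s z≤n
nCk>0 (suc n) (suc k) (s≤s k≤n) = ℕₚ.<-≤-trans (nCk>0 n k k≤n)
  (subst (n C k ≤_) (nCk+nC[k+1]≡[n+1]C[k+1] n k) (ℕₚ.m≤m+n _ _))

module _ {c ℓ₁ ℓ₂} (F : SqrtOrderedField c ℓ₁ ℓ₂) where

  open SqrtOrderedField F hiding (zero)
    renaming (_+_ to _+ᶠ_; _*_ to _*ᶠ_; -_ to -ᶠ_; refl to ≈-refl; sym to ≈-sym; trans to ≈-trans; reflexive to ≈-reflexive)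
  open Laplacians F
  open import Relation.Binary.Reasoning.Setoid setoid
  open import Algebra.Properties.Ring ring using (-‿distribˡ-*; -‿distribʳ-*; -‿involutive; -0#≈0#)
  open import Algebra.Properties.CommutativeSemigroup *-commutativeSemigroup using (x∙yz≈y∙xz; x∙yz≈zx∙y; xy∙z≈xz∙y; xy∙z≈y∙xz)
  private
    module <ᶠ = IsStrictTotalOrder isStrictTotalOrder
    module Solver = Algebra.Solver.Ring.NaturalCoefficients.Default commutativeSemiring

  *-zeroˡ-≈ : ∀ {x} y → x ≈ 0# → x *ᶠ y ≈ 0#
  *-zeroˡ-≈ y x≈0 = ≈-trans (*-cong x≈0 ≈-refl) (zeroˡ y)

  *-zeroʳ-≈ : ∀ x {y} → y ≈ 0# → x *ᶠ y ≈ 0#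
  *-zeroʳ-≈ x y≈0 = ≈-trans (*-cong ≈-refl y≈0) (zeroʳ x)

  -x*-y≈x*y : ∀ x y → (-ᶠ x) *ᶠ (-ᶠ y) ≈ x *ᶠ y
  -x*-y≈x*y x y = begin
    (-ᶠ x) *ᶠ (-ᶠ y)  ≈⟨ -‿distribˡ-* x (-ᶠ y) ⟨
    -ᶠ (x *ᶠ (-ᶠ y))  ≈⟨ -‿cong (-‿distribʳ-* x y) ⟨
    -ᶠ (-ᶠ (x *ᶠ y))  ≈⟨ -‿involutive (x *ᶠ y) ⟩
    x *ᶠ y            ∎

  sign-+ : ∀ m n → sign (m + n) ≈ sign m *ᶠ sign n
  sign-+ zero    n = ≈-sym (*-identityˡ (sign n))
  sign-+ (suc m) n = ≈-trans (-‿cong (sign-+ m n)) (-‿distribˡ-* (sign m) (sign n))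

  sign²≈1 : ∀ m → sign m *ᶠ sign m ≈ 1#
  sign²≈1 zero    = *-identityˡ 1#
  sign²≈1 (suc m) = ≈-trans (-x*-y≈x*y (sign m) (sign m)) (sign²≈1 m)

  ⟦⟧-+ : ∀ m n → ⟦ m + n ⟧ ≈ ⟦ m ⟧ +ᶠ ⟦ n ⟧
  ⟦⟧-+ zero    n = ≈-sym (+-identityˡ ⟦ n ⟧)
  ⟦⟧-+ (suc m) n = ≈-trans (+-cong ≈-refl (⟦⟧-+ m n)) (≈-sym (+-assoc 1# ⟦ m ⟧ ⟦ n ⟧))

  ⟦⟧-* : ∀ m n → ⟦ m * n ⟧ ≈ ⟦ m ⟧ *ᶠ ⟦ n ⟧
  ⟦⟧-* zero    n = ≈-sym (zeroˡ ⟦ n ⟧)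
  ⟦⟧-* (suc m) n = begin
    ⟦ n + m * n ⟧                  ≈⟨ ⟦⟧-+ n (m * n) ⟩
    ⟦ n ⟧ +ᶠ ⟦ m * n ⟧             ≈⟨ +-cong (≈-sym (*-identityˡ ⟦ n ⟧)) (⟦⟧-* m n) ⟩
    1# *ᶠ ⟦ n ⟧ +ᶠ ⟦ m ⟧ *ᶠ ⟦ n ⟧  ≈⟨ distribʳ ⟦ n ⟧ 1# ⟦ m ⟧ ⟨
    (1# +ᶠ ⟦ m ⟧) *ᶠ ⟦ n ⟧         ∎

  ⟦⟧>0 : ∀ {m} → 0 < m → 0# <ᶠ ⟦ m ⟧
  ⟦⟧>0 {suc zero}    _ = <ᶠ.<-respʳ-≈ (≈-sym (+-identityʳ 1#)) 0<1
  ⟦⟧>0 {suc (suc m)} _ =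
    <ᶠ.trans (⟦⟧>0 {suc m} (s≤s z≤n)) (<ᶠ.<-respˡ-≈ (+-identityˡ _) (+-monoˡ-< ⟦ suc m ⟧ 0<1))

  inv-unique : ∀ x y → 0# <ᶠ x → x *ᶠ y ≈ 1# → y ≈ inv x
  inv-unique x y x>0 xy≈1 = begin
    y                    ≈⟨ *-identityʳ y ⟨
    y *ᶠ 1#              ≈⟨ *-cong ≈-refl (inv-rinv x x>0) ⟨
    y *ᶠ (x *ᶠ inv x)    ≈⟨ x∙yz≈y∙xz y x (inv x) ⟩
    x *ᶠ (y *ᶠ inv x)    ≈⟨ *-assoc x y (inv x) ⟨
    (x *ᶠ y) *ᶠ inv x    ≈⟨ *-cong xy≈1 ≈-refl ⟩
    1# *ᶠ inv x          ≈⟨ *-identityˡ (inv x) ⟩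
    inv x                ∎

  invSqrt²≈inv : ∀ x → 0# <ᶠ x → invSqrt x *ᶠ invSqrt x ≈ inv x
  invSqrt²≈inv x x>0 = inv-unique x (i *ᶠ i) x>0 (begin
    x *ᶠ (i *ᶠ i)               ≈⟨ *-cong (sqrt-sq x x>0) ≈-refl ⟨
    (s *ᶠ s) *ᶠ (i *ᶠ i)        ≈⟨ Solver.solve 2 (λ s i → (s :* s) :* (i :* i) := (s :* i) :* (s :* i)) ≈-refl s i ⟩
    (s *ᶠ i) *ᶠ (s *ᶠ i)        ≈⟨ *-cong (inv-rinv s s>0) (inv-rinv s s>0) ⟩
    1# *ᶠ 1#                    ≈⟨ *-identityˡ 1# ⟩
    1#                          ∎)
    where
    open Solver using (_:*_; _:=_)
    s = sqrt x
    i = inv s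
    s>0 = sqrt-pos x x>0

  ⟦⟧-ratio : ∀ a b d n → 0 < d → n * a ≡ b * d → ⟦ a ⟧ *ᶠ (inv ⟦ d ⟧ *ᶠ ⟦ n ⟧) ≈ ⟦ b ⟧
  ⟦⟧-ratio a b d n d>0 na≡bd = begin
    ⟦ a ⟧ *ᶠ (inv ⟦ d ⟧ *ᶠ ⟦ n ⟧)    ≈⟨ x∙yz≈zx∙y ⟦ a ⟧ (inv ⟦ d ⟧) ⟦ n ⟧ ⟩
    (⟦ n ⟧ *ᶠ ⟦ a ⟧) *ᶠ inv ⟦ d ⟧    ≈⟨ *-cong (⟦⟧-* n a) ≈-refl ⟨
    ⟦ n * a ⟧ *ᶠ inv ⟦ d ⟧           ≡⟨ cong (λ m → ⟦ m ⟧ *ᶠ inv ⟦ d ⟧) na≡bd ⟩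
    ⟦ b * d ⟧ *ᶠ inv ⟦ d ⟧           ≈⟨ *-cong (⟦⟧-* b d) ≈-refl ⟩
    (⟦ b ⟧ *ᶠ ⟦ d ⟧) *ᶠ inv ⟦ d ⟧    ≈⟨ *-assoc ⟦ b ⟧ ⟦ d ⟧ (inv ⟦ d ⟧) ⟩
    ⟦ b ⟧ *ᶠ (⟦ d ⟧ *ᶠ inv ⟦ d ⟧)    ≈⟨ *-cong ≈-refl (inv-rinv ⟦ d ⟧ (⟦⟧>0 d>0)) ⟩
    ⟦ b ⟧ *ᶠ 1#                      ≈⟨ *-identityʳ ⟦ b ⟧ ⟩
    ⟦ b ⟧                            ∎

  [_]·_ : Bool → Carrier → Carrier
  [ b ]· x = if b then x else 0#

  []·-cong : ∀ b {x y} → x ≈ y → [ b ]· x ≈ [ b ]· y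
  []·-cong true  x≈y = x≈y
  []·-cong false _   = ≈-refl

  []·-zero : ∀ b → [ b ]· 0# ≈ 0#
  []·-zero true  = ≈-refl
  []·-zero false = ≈-refl

  *-[]· : ∀ b x y → x *ᶠ ([ b ]· y) ≈ [ b ]· (x *ᶠ y)
  *-[]· true  x y = ≈-refl
  *-[]· false x y = zeroʳ x

  []·-∧ : ∀ a b x → [ a ∧ b ]· x ≡ [ a ]· ([ b ]· x)
  []·-∧ true  b x = refl
  []·-∧ false b x = refl

  []·-restrict : ∀ a b c {x y} → (c ≡ true → a ≡ true) → (b ≡ true → c ≡ true → x ≈ y) →
                 [ a ∧ b ]· ([ c ]· x) ≈ [ b ∧ c ]· y
  []·-restrict a     false c     _   _   rewrite ∧-zeroʳ a = ≈-refl
  []·-restrict a     true  false _   _   = []·-zero (a ∧ true)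
  []·-restrict a     true  true  c⇒a x≈y rewrite c⇒a refl = x≈y refl refl

  [eqᵇ]·-subst : ∀ {n} (f : Subset n → Carrier) x (σ ρ : Subset n) → ([ eqᵇ σ ρ ]· x) *ᶠ f σ ≈ ([ eqᵇ σ ρ ]· x) *ᶠ f ρ
  [eqᵇ]·-subst f x σ ρ with eqᵇ σ ρ in σ≐ρ
  ... | true  = *-cong ≈-refl (≈-reflexive (cong f (eqᵇ⇒≡ σ ρ σ≐ρ)))
  ... | false = ≈-trans (zeroˡ (f σ)) (≈-sym (zeroˡ (f ρ)))

  sumL-cong : ∀ {a} {A : Set a} (xs : List A) {f g : A → Carrier} → (∀ x → f x ≈ g x) → sumL xs f ≈ sumL xs g
  sumL-cong []       _   = ≈-refl
  sumL-cong (x ∷ xs) f≈g = +-cong (f≈g x) (sumL-cong xs f≈g)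

  sumL-zero : ∀ {a} {A : Set a} (xs : List A) {f : A → Carrier} → (∀ x → f x ≈ 0#) → sumL xs f ≈ 0#
  sumL-zero []       _   = ≈-refl
  sumL-zero (x ∷ xs) f≈0 = ≈-trans (+-cong (f≈0 x) (sumL-zero xs f≈0)) (+-identityˡ 0#)

  sumL-filterᵇ : ∀ {a} {A : Set a} (p : A → Bool) (xs : List A) (f : A → Carrier) →
                 sumL (filterᵇ p xs) f ≈ sumL xs (λ x → [ p x ]· f x)
  sumL-filterᵇ p []       f = ≈-refl
  sumL-filterᵇ p (x ∷ xs) f with p x
  ... | true  = +-cong ≈-refl (sumL-filterᵇ p xs f)
  ... | false = ≈-trans (sumL-filterᵇ p xs f) (≈-sym (+-identityˡ _))

  sumL-++ : ∀ {a} {A : Set a} (xs ys : List A) (f : A → Carrier) → sumL (xs ++ ys) f ≈ sumL xs f +ᶠ sumL ys f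
  sumL-++ []       ys f = ≈-sym (+-identityˡ _)
  sumL-++ (x ∷ xs) ys f = ≈-trans (+-cong ≈-refl (sumL-++ xs ys f)) (≈-sym (+-assoc (f x) _ _))

  sumL-map : ∀ {a b} {A : Set a} {B : Set b} (h : A → B) (xs : List A) (f : B → Carrier) → sumL (map h xs) f ≡ sumL xs (f ∘ h)
  sumL-map h []       f = refl
  sumL-map h (x ∷ xs) f = cong (f (h x) +ᶠ_) (sumL-map h xs f)

  sumL-*ˡ : ∀ {a} {A : Set a} (xs : List A) (x : Carrier) (f : A → Carrier) → sumL xs (λ y → x *ᶠ f y) ≈ x *ᶠ sumL xs f
  sumL-*ˡ []       x f = ≈-sym (zeroʳ x)
  sumL-*ˡ (y ∷ xs) x f = ≈-trans (+-cong ≈-refl (sumL-*ˡ xs x f)) (≈-sym (distribˡ x (f y) _))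

  sumL-allFin-suc : ∀ n (g : Fin (suc n) → Carrier) → sumL (allFin (suc n)) g ≡ g Fin.zero +ᶠ sumL (allFin n) (g ∘ Fin.suc)
  sumL-allFin-suc n g = trans (cong (λ vs → sumL vs g) (allFin-suc n)) (cong (g Fin.zero +ᶠ_) (sumL-map Fin.suc (allFin n) g))

  Σˢ : (n : ℕ) → (Subset n → Carrier) → Carrier
  Σˢ n f = sumL (allSubsets n) f

  Σˢ-cong : ∀ n {f g : Subset n → Carrier} → (∀ ρ → f ρ ≈ g ρ) → Σˢ n f ≈ Σˢ n g
  Σˢ-cong n = sumL-cong (allSubsets n)

  Σˢ-zero : ∀ n {f : Subset n → Carrier} → (∀ ρ → f ρ ≈ 0#) → Σˢ n f ≈ 0#
  Σˢ-zero n = sumL-zero (allSubsets n)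

  Σˢ-suc : ∀ n (f : Subset (suc n) → Carrier) → Σˢ (suc n) f ≈ Σˢ n (f ∘ (outside ∷_)) +ᶠ Σˢ n (f ∘ (inside ∷_))
  Σˢ-suc n f = ≈-trans (sumL-++ (map (outside ∷_) (allSubsets n)) _ f)
    (≈-reflexive (cong₂ _+ᶠ_ (sumL-map (outside ∷_) (allSubsets n) f) (sumL-map (inside ∷_) (allSubsets n) f)))

  Σˢ-single : ∀ n (σ : Subset n) (f : Subset n → Carrier) → (∀ ρ → ρ ≢ σ → f ρ ≈ 0#) → Σˢ n f ≈ f σ
  Σˢ-single zero    []            f _    = +-identityʳ (f [])
  Σˢ-single (suc n) (outside ∷ σ) f only = begin
    Σˢ (suc n) f                                           ≈⟨ Σˢ-suc n f ⟩
    Σˢ n (f ∘ (outside ∷_)) +ᶠ Σˢ n (f ∘ (inside ∷_))      ≈⟨ +-cong (Σˢ-single n σ _ (λ ρ ρ≢σ → only _ (ρ≢σ ∘ ∷-injectiveʳ)))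
                                                                     (Σˢ-zero n (λ ρ → only _ (λ ()))) ⟩
    f (outside ∷ σ) +ᶠ 0#                                  ≈⟨ +-identityʳ _ ⟩
    f (outside ∷ σ)                                        ∎
  Σˢ-single (suc n) (inside ∷ σ)  f only = begin
    Σˢ (suc n) f                                           ≈⟨ Σˢ-suc n f ⟩
    Σˢ n (f ∘ (outside ∷_)) +ᶠ Σˢ n (f ∘ (inside ∷_))      ≈⟨ +-cong (Σˢ-zero n (λ ρ → only _ (λ ())))
                                                                     (Σˢ-single n σ _ (λ ρ ρ≢σ → only _ (ρ≢σ ∘ ∷-injectiveʳ))) ⟩
    0# +ᶠ f (inside ∷ σ)                                   ≈⟨ +-identityˡ _ ⟩
    f (inside ∷ σ)                                         ∎

  sumL-faces : ∀ {n} (X : Subset n → Bool) m (f : Subset n → Carrier) →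
               sumL (faces X m) f ≈ Σˢ n (λ ρ → [ X ρ ∧ (∣ ρ ∣ ≡ᵇ suc m) ]· f ρ)
  sumL-faces {n} X m f = sumL-filterᵇ (λ ρ → X ρ ∧ (∣ ρ ∣ ≡ᵇ suc m)) (allSubsets n) f

  Σˢ-disjoint≈Σˢ-⊇ : ∀ n (η : Subset n) (f : Subset n → Carrier) →
                     Σˢ n (λ ρ → [ ∣ ρ ∩ η ∣ ≡ᵇ 0 ]· f ρ) ≈ Σˢ n (λ ρ → [ η ⊆ᵇ ρ ]· f (ρ ─ η))
  Σˢ-disjoint≈Σˢ-⊇ zero    []            f = ≈-refl
  Σˢ-disjoint≈Σˢ-⊇ (suc n) (outside ∷ η) f = begin
    Σˢ (suc n) (λ ρ → [ ∣ ρ ∩ (outside ∷ η) ∣ ≡ᵇ 0 ]· f ρ)  ≈⟨ Σˢ-suc n _ ⟩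
    _ +ᶠ _
      ≈⟨ +-cong (Σˢ-disjoint≈Σˢ-⊇ n η (f ∘ (outside ∷_))) (Σˢ-disjoint≈Σˢ-⊇ n η (f ∘ (inside ∷_))) ⟩
    _ +ᶠ _                                                  ≈⟨ Σˢ-suc n _ ⟨
    Σˢ (suc n) (λ ρ → [ (outside ∷ η) ⊆ᵇ ρ ]· f (ρ ─ (outside ∷ η))) ∎
  Σˢ-disjoint≈Σˢ-⊇ (suc n) (inside ∷ η)  f = begin
    Σˢ (suc n) (λ ρ → [ ∣ ρ ∩ (inside ∷ η) ∣ ≡ᵇ 0 ]· f ρ)   ≈⟨ Σˢ-suc n _ ⟩
    _ +ᶠ Σˢ n (λ _ → 0#)                                    ≈⟨ +-comm _ _ ⟩
    Σˢ n (λ _ → 0#) +ᶠ _                                    ≈⟨ +-cong ≈-refl (Σˢ-disjoint≈Σˢ-⊇ n η (f ∘ (outside ∷_))) ⟩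
    Σˢ n (λ _ → 0#) +ᶠ _                                    ≈⟨ Σˢ-suc n _ ⟨
    Σˢ (suc n) (λ ρ → [ (inside ∷ η) ⊆ᵇ ρ ]· f (ρ ─ (inside ∷ η))) ∎

  Σˢ-cofacets : ∀ n (σ : Subset n) (g : Subset n → Carrier) →
                Σˢ n (λ ρ → [ isFacet σ ρ ]· g ρ) ≈ sumL (allFin n) (λ v → [ not (lookup σ v) ]· g (σ ∪ ⁅ v ⁆))
  Σˢ-cofacets zero    []            g = +-identityˡ 0#
  Σˢ-cofacets (suc n) (outside ∷ σ) g = begin
    Σˢ (suc n) (λ ρ → [ isFacet (outside ∷ σ) ρ ]· g ρ)                           ≈⟨ Σˢ-suc n _ ⟩
    Σˢ n (λ ρ → [ isFacet σ ρ ]· g (outside ∷ ρ)) +ᶠ Σˢ n (λ ρ → [ eqᵇ σ ρ ]· g (inside ∷ ρ))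
      ≈⟨ +-cong (Σˢ-cofacets n σ (g ∘ (outside ∷_))) (Σˢ-single n σ _ only-σ) ⟩
    rest +ᶠ [ eqᵇ σ σ ]· g (inside ∷ σ)      ≈⟨ +-comm _ _ ⟩
    [ eqᵇ σ σ ]· g (inside ∷ σ) +ᶠ rest
      ≡⟨ cong (_+ᶠ rest) (trans (cong ([_]· g (inside ∷ σ)) (eqᵇ-refl σ)) (cong (g ∘ (inside ∷_)) (sym (∪-identityʳ σ)))) ⟩
    g (inside ∷ (σ ∪ ∅)) +ᶠ rest             ≡⟨ sumL-allFin-suc n _ ⟨
    sumL (allFin (suc n)) (λ v → [ not (lookup (outside ∷ σ) v) ]· g ((outside ∷ σ) ∪ ⁅ v ⁆)) ∎
    where
    rest = sumL (allFin n) (λ v → [ not (lookup σ v) ]· g (outside ∷ (σ ∪ ⁅ v ⁆)))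
    only-σ : ∀ ρ → ρ ≢ σ → [ eqᵇ σ ρ ]· g (inside ∷ ρ) ≈ 0#
    only-σ ρ ρ≢σ with eqᵇ σ ρ in σ≐ρ
    ... | true  = ⊥-elim (ρ≢σ (sym (eqᵇ⇒≡ σ ρ σ≐ρ)))
    ... | false = ≈-refl
  Σˢ-cofacets (suc n) (inside ∷ σ)  g = begin
    Σˢ (suc n) (λ ρ → [ isFacet (inside ∷ σ) ρ ]· g ρ)                            ≈⟨ Σˢ-suc n _ ⟩
    Σˢ n (λ _ → 0#) +ᶠ Σˢ n (λ ρ → [ isFacet σ ρ ]· g (inside ∷ ρ))
      ≈⟨ +-cong (Σˢ-zero n (λ _ → ≈-refl)) (Σˢ-cofacets n σ (g ∘ (inside ∷_))) ⟩
    0# +ᶠ sumL (allFin n) (λ v → [ not (lookup σ v) ]· g (inside ∷ (σ ∪ ⁅ v ⁆)))   ≡⟨ sumL-allFin-suc n _ ⟨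
    sumL (allFin (suc n)) (λ v → [ not (lookup (inside ∷ σ) v) ]· g ((inside ∷ σ) ∪ ⁅ v ⁆)) ∎

  Σˢ-subsets-of-size : ∀ n (A : Subset n) j (x : Carrier) →
                       Σˢ n (λ η → [ (∣ η ∣ ≡ᵇ j) ∧ (η ⊆ᵇ A) ]· x) ≈ ⟦ ∣ A ∣ C j ⟧ *ᶠ x
  Σˢ-subsets-of-size zero    []           zero    x =
    ≈-trans (+-identityʳ x) (≈-sym (≈-trans (*-cong (+-identityʳ 1#) ≈-refl) (*-identityˡ x)))
  Σˢ-subsets-of-size zero    []           (suc j) x = ≈-trans (+-identityʳ 0#) (≈-sym (zeroˡ x))
  Σˢ-subsets-of-size (suc n) (outside ∷ A) j      x = begin
    Σˢ (suc n) (λ η → [ (∣ η ∣ ≡ᵇ j) ∧ (η ⊆ᵇ (outside ∷ A)) ]· x)  ≈⟨ Σˢ-suc n _ ⟩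
    Σˢ n (λ η → [ (∣ η ∣ ≡ᵇ j) ∧ (η ⊆ᵇ A) ]· x) +ᶠ Σˢ n (λ η → [ (suc ∣ η ∣ ≡ᵇ j) ∧ false ]· x)
      ≈⟨ +-cong (Σˢ-subsets-of-size n A j x) (Σˢ-zero n (λ η → ≈-reflexive (cong ([_]· x) (∧-zeroʳ _)))) ⟩
    ⟦ ∣ A ∣ C j ⟧ *ᶠ x +ᶠ 0#                                         ≈⟨ +-identityʳ _ ⟩
    ⟦ ∣ A ∣ C j ⟧ *ᶠ x                                               ∎
  Σˢ-subsets-of-size (suc n) (inside ∷ A)  zero    x = begin
    Σˢ (suc n) (λ η → [ (∣ η ∣ ≡ᵇ 0) ∧ (η ⊆ᵇ (inside ∷ A)) ]· x)   ≈⟨ Σˢ-suc n _ ⟩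
    Σˢ n (λ η → [ (∣ η ∣ ≡ᵇ 0) ∧ (η ⊆ᵇ A) ]· x) +ᶠ Σˢ n (λ _ → 0#)
      ≈⟨ +-cong (Σˢ-subsets-of-size n A zero x) (Σˢ-zero n (λ _ → ≈-refl)) ⟩
    ⟦ ∣ A ∣ C 0 ⟧ *ᶠ x +ᶠ 0#                                         ≈⟨ +-identityʳ _ ⟩
    ⟦ 1 ⟧ *ᶠ x                                                       ∎
  Σˢ-subsets-of-size (suc n) (inside ∷ A)  (suc j) x = begin
    Σˢ (suc n) (λ η → [ (∣ η ∣ ≡ᵇ suc j) ∧ (η ⊆ᵇ (inside ∷ A)) ]· x)   ≈⟨ Σˢ-suc n _ ⟩
    Σˢ n (λ η → [ (∣ η ∣ ≡ᵇ suc j) ∧ (η ⊆ᵇ A) ]· x) +ᶠ Σˢ n (λ η → [ (∣ η ∣ ≡ᵇ j) ∧ (η ⊆ᵇ A) ]· x)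
      ≈⟨ +-cong (Σˢ-subsets-of-size n A (suc j) x) (Σˢ-subsets-of-size n A j x) ⟩
    ⟦ ∣ A ∣ C suc j ⟧ *ᶠ x +ᶠ ⟦ ∣ A ∣ C j ⟧ *ᶠ x                           ≈⟨ +-comm _ _ ⟩
    ⟦ ∣ A ∣ C j ⟧ *ᶠ x +ᶠ ⟦ ∣ A ∣ C suc j ⟧ *ᶠ x                           ≈⟨ distribʳ x _ _ ⟨
    (⟦ ∣ A ∣ C j ⟧ +ᶠ ⟦ ∣ A ∣ C suc j ⟧) *ᶠ x                              ≈⟨ *-cong (⟦⟧-+ (∣ A ∣ C j) _) ≈-refl ⟨
    ⟦ ∣ A ∣ C j + ∣ A ∣ C suc j ⟧ *ᶠ x                                    ≡⟨ cong (λ m → ⟦ m ⟧ *ᶠ x) (nCk+nC[k+1]≡[n+1]C[k+1] ∣ A ∣ j) ⟩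
    ⟦ suc ∣ A ∣ C suc j ⟧ *ᶠ x                                            ∎

  bd-nonfacet : ∀ {n} (σ ρ : Subset n) → isFacet σ ρ ≡ false → bd σ ρ ≡ 0#
  bd-nonfacet σ ρ e = cong (λ b → if b then sign (bdExp σ ρ) else 0#) e

  bd-facet : ∀ {n} (σ ρ : Subset n) → isFacet σ ρ ≡ true → bd σ ρ ≡ sign (bdExp σ ρ)
  bd-facet σ ρ e = cong (λ b → if b then sign (bdExp σ ρ) else 0#) e

  bd-⊈ : ∀ {n} (η σ ρ : Subset n) → η ⊆ᵇ σ ≡ true → η ⊆ᵇ ρ ≡ false → bd σ ρ ≡ 0#
  bd-⊈ η σ ρ η⊆σ η⊈ρ with isFacet σ ρ in σ⋖ρ
  ... | false = refl
  ... | true with () ← trans (sym (⊆ᵇ-trans η σ ρ η⊆σ (isFacet⇒⊆ᵇ σ ρ σ⋖ρ))) η⊈ρ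

  bd-outside-outside : ∀ {n} (σ ρ : Subset n) → bd (outside ∷ σ) (outside ∷ ρ) ≡ bd σ ρ
  bd-outside-outside σ ρ = cong (λ e → if isFacet σ ρ then sign e else 0#) (bdExp-outside-outside σ ρ)

  bd-outside-inside : ∀ {n} (σ ρ : Subset n) → bd (outside ∷ σ) (inside ∷ ρ) ≡ [ eqᵇ σ ρ ]· 1#
  bd-outside-inside σ ρ = cong (λ e → if eqᵇ σ ρ then sign e else 0#) (bdExp-outside-inside σ ρ)

  bd-inside-inside : ∀ {n} (σ ρ : Subset n) → bd (inside ∷ σ) (inside ∷ ρ) ≈ -ᶠ bd σ ρ
  bd-inside-inside σ ρ with isFacet σ ρ in σ⋖ρ
  ... | true  = ≈-reflexive (cong sign (bdExp-inside-inside σ ρ σ⋖ρ))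
  ... | false = ≈-sym -0#≈0#

  sign∣─∣*bd : ∀ {n} (η σ ρ : Subset n) → η ⊆ᵇ σ ≡ true → η ⊆ᵇ ρ ≡ true →
               sign ∣ σ ─ η ∣ *ᶠ bd σ ρ ≈ (-ᶠ bd σ ρ) *ᶠ sign ∣ ρ ─ η ∣
  sign∣─∣*bd η σ ρ η⊆σ η⊆ρ with isFacet σ ρ in σ⋖ρ
  ... | false = ≈-trans (zeroʳ _) (≈-sym (*-zeroˡ-≈ _ -0#≈0#))
  ... | true  = begin
    sign ∣ σ ─ η ∣ *ᶠ s               ≈⟨ *-comm _ _ ⟩
    s *ᶠ sign ∣ σ ─ η ∣               ≈⟨ -x*-y≈x*y _ _ ⟨
    (-ᶠ s) *ᶠ sign (suc ∣ σ ─ η ∣)    ≡⟨ cong (λ m → (-ᶠ s) *ᶠ sign m) ∣ρ─η∣≡1+∣σ─η∣ ⟨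
    (-ᶠ s) *ᶠ sign ∣ ρ ─ η ∣          ∎
    where
    s = sign (bdExp σ ρ)
    ∣ρ─η∣≡1+∣σ─η∣ : ∣ ρ ─ η ∣ ≡ suc ∣ σ ─ η ∣
    ∣ρ─η∣≡1+∣σ─η∣ = isFacet⇒∣∣≡suc (σ ─ η) (ρ ─ η) (trans (isFacet-─-cancel η σ ρ η⊆σ η⊆ρ) σ⋖ρ)

  bd-─-sign : ∀ {n} (η σ ρ : Subset n) → η ⊆ᵇ σ ≡ true → η ⊆ᵇ ρ ≡ true →
              bd (σ ─ η) (ρ ─ η) *ᶠ sign (pairCount σ η) ≈ bd σ ρ *ᶠ sign (pairCount ρ η)
  bd-─-sign []            []            []            _   _   = ≈-refl
  bd-─-sign (inside ∷ η)  (outside ∷ σ) _             ()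
  bd-─-sign (inside ∷ η)  (inside ∷ σ)  (outside ∷ ρ) _   ()
  bd-─-sign (inside ∷ η)  (inside ∷ σ)  (inside ∷ ρ)  η⊆σ η⊆ρ = begin
    bd (outside ∷ (σ ─ η)) (outside ∷ (ρ ─ η)) *ᶠ sign (pairCount (inside ∷ σ) (inside ∷ η))
      ≡⟨ cong₂ _*ᶠ_ (bd-outside-outside (σ ─ η) (ρ ─ η)) (cong sign (pairCount-∷ inside inside σ η)) ⟩
    bd (σ ─ η) (ρ ─ η) *ᶠ sign (∣ σ ─ η ∣ + pairCount σ η)          ≈⟨ *-cong ≈-refl (sign-+ ∣ σ ─ η ∣ _) ⟩
    bd (σ ─ η) (ρ ─ η) *ᶠ (sign ∣ σ ─ η ∣ *ᶠ sign (pairCount σ η))   ≈⟨ x∙yz≈y∙xz _ _ _ ⟩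
    sign ∣ σ ─ η ∣ *ᶠ (bd (σ ─ η) (ρ ─ η) *ᶠ sign (pairCount σ η))   ≈⟨ *-cong ≈-refl (bd-─-sign η σ ρ η⊆σ η⊆ρ) ⟩
    sign ∣ σ ─ η ∣ *ᶠ (bd σ ρ *ᶠ sign (pairCount ρ η))               ≈⟨ *-assoc _ _ _ ⟨
    (sign ∣ σ ─ η ∣ *ᶠ bd σ ρ) *ᶠ sign (pairCount ρ η)               ≈⟨ *-cong (sign∣─∣*bd η σ ρ η⊆σ η⊆ρ) ≈-refl ⟩
    ((-ᶠ bd σ ρ) *ᶠ sign ∣ ρ ─ η ∣) *ᶠ sign (pairCount ρ η)          ≈⟨ *-assoc _ _ _ ⟩
    (-ᶠ bd σ ρ) *ᶠ (sign ∣ ρ ─ η ∣ *ᶠ sign (pairCount ρ η))          ≈⟨ *-cong (bd-inside-inside σ ρ) (sign-+ ∣ ρ ─ η ∣ _) ⟨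
    bd (inside ∷ σ) (inside ∷ ρ) *ᶠ sign (∣ ρ ─ η ∣ + pairCount ρ η)
      ≡⟨ cong (λ m → bd (inside ∷ σ) (inside ∷ ρ) *ᶠ sign m) (pairCount-∷ inside inside ρ η) ⟨
    bd (inside ∷ σ) (inside ∷ ρ) *ᶠ sign (pairCount (inside ∷ ρ) (inside ∷ η)) ∎
  bd-─-sign (outside ∷ η) (inside ∷ σ)  (inside ∷ ρ)  η⊆σ η⊆ρ = begin
    bd (inside ∷ (σ ─ η)) (inside ∷ (ρ ─ η)) *ᶠ sign (pairCount (inside ∷ σ) (outside ∷ η))
      ≈⟨ *-cong (bd-inside-inside (σ ─ η) (ρ ─ η)) (≈-reflexive (cong sign (pairCount-∷ inside outside σ η))) ⟩
    (-ᶠ bd (σ ─ η) (ρ ─ η)) *ᶠ sign (pairCount σ η)   ≈⟨ -‿distribˡ-* _ _ ⟨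
    -ᶠ (bd (σ ─ η) (ρ ─ η) *ᶠ sign (pairCount σ η))   ≈⟨ -‿cong (bd-─-sign η σ ρ η⊆σ η⊆ρ) ⟩
    -ᶠ (bd σ ρ *ᶠ sign (pairCount ρ η))               ≈⟨ -‿distribˡ-* _ _ ⟩
    (-ᶠ bd σ ρ) *ᶠ sign (pairCount ρ η)
      ≈⟨ *-cong (bd-inside-inside σ ρ) (≈-reflexive (cong sign (pairCount-∷ inside outside ρ η))) ⟨
    bd (inside ∷ σ) (inside ∷ ρ) *ᶠ sign (pairCount (inside ∷ ρ) (outside ∷ η)) ∎
  bd-─-sign (outside ∷ η) (outside ∷ σ) (outside ∷ ρ) η⊆σ η⊆ρ = begin
    bd (outside ∷ (σ ─ η)) (outside ∷ (ρ ─ η)) *ᶠ sign (pairCount (outside ∷ σ) (outside ∷ η))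
      ≡⟨ cong₂ _*ᶠ_ (bd-outside-outside (σ ─ η) (ρ ─ η)) (cong sign (pairCount-∷ outside outside σ η)) ⟩
    bd (σ ─ η) (ρ ─ η) *ᶠ sign (pairCount σ η)   ≈⟨ bd-─-sign η σ ρ η⊆σ η⊆ρ ⟩
    bd σ ρ *ᶠ sign (pairCount ρ η)
      ≡⟨ cong₂ _*ᶠ_ (bd-outside-outside σ ρ) (cong sign (pairCount-∷ outside outside ρ η)) ⟨
    bd (outside ∷ σ) (outside ∷ ρ) *ᶠ sign (pairCount (outside ∷ ρ) (outside ∷ η)) ∎
  bd-─-sign (outside ∷ η) (inside ∷ σ)  (outside ∷ ρ) _   _   = ≈-trans (zeroˡ _) (≈-sym (zeroˡ _))
  bd-─-sign (outside ∷ η) (outside ∷ σ) (inside ∷ ρ)  η⊆σ η⊆ρ = begin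
    bd (outside ∷ (σ ─ η)) (inside ∷ (ρ ─ η)) *ᶠ sign (pairCount (outside ∷ σ) (outside ∷ η))
      ≡⟨ cong₂ _*ᶠ_ (trans (bd-outside-inside (σ ─ η) (ρ ─ η)) (cong ([_]· 1#) (eqᵇ-─-cancel η σ ρ η⊆σ η⊆ρ)))
                    (cong sign (pairCount-∷ outside outside σ η)) ⟩
    ([ eqᵇ σ ρ ]· 1#) *ᶠ sign (pairCount σ η)   ≈⟨ [eqᵇ]·-subst (λ x → sign (pairCount x η)) 1# σ ρ ⟩
    ([ eqᵇ σ ρ ]· 1#) *ᶠ sign (pairCount ρ η)
      ≡⟨ cong₂ _*ᶠ_ (bd-outside-inside σ ρ) (cong sign (pairCount-∷ inside outside ρ η)) ⟨
    bd (outside ∷ σ) (inside ∷ ρ) *ᶠ sign (pairCount (inside ∷ ρ) (outside ∷ η)) ∎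

  bd-─-product : ∀ {n} (η σ τ ρ : Subset n) (x : Carrier) → η ⊆ᵇ σ ≡ true → η ⊆ᵇ τ ≡ true → η ⊆ᵇ ρ ≡ true →
                 (sign (pairCount σ η) *ᶠ sign (pairCount τ η)) *ᶠ (bd (σ ─ η) (ρ ─ η) *ᶠ x *ᶠ bd (τ ─ η) (ρ ─ η))
                   ≈ bd σ ρ *ᶠ x *ᶠ bd τ ρ
  bd-─-product η σ τ ρ x η⊆σ η⊆τ η⊆ρ = begin
    (sσ *ᶠ sτ) *ᶠ (bd (σ ─ η) (ρ ─ η) *ᶠ x *ᶠ bd (τ ─ η) (ρ ─ η))
      ≈⟨ Solver.solve 5 (λ s t a x b → (s :* t) :* ((a :* x) :* b) := ((a :* s) :* x) :* (b :* t)) ≈-refl sσ sτ _ x _ ⟩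
    (bd (σ ─ η) (ρ ─ η) *ᶠ sσ) *ᶠ x *ᶠ (bd (τ ─ η) (ρ ─ η) *ᶠ sτ)
      ≈⟨ *-cong (*-cong (bd-─-sign η σ ρ η⊆σ η⊆ρ) ≈-refl) (bd-─-sign η τ ρ η⊆τ η⊆ρ) ⟩
    (bd σ ρ *ᶠ sρ) *ᶠ x *ᶠ (bd τ ρ *ᶠ sρ)
      ≈⟨ Solver.solve 4 (λ a s x b → ((a :* s) :* x) :* (b :* s) := ((a :* x) :* b) :* (s :* s)) ≈-refl (bd σ ρ) sρ x (bd τ ρ) ⟩
    bd σ ρ *ᶠ x *ᶠ bd τ ρ *ᶠ (sρ *ᶠ sρ)   ≈⟨ *-cong ≈-refl (sign²≈1 (pairCount ρ η)) ⟩
    bd σ ρ *ᶠ x *ᶠ bd τ ρ *ᶠ 1#           ≈⟨ *-identityʳ _ ⟩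
    bd σ ρ *ᶠ x *ᶠ bd τ ρ                 ∎
    where
    open Solver using (_:*_; _:=_)
    sσ = sign (pairCount σ η)
    sτ = sign (pairCount τ η)
    sρ = sign (pairCount ρ η)

  ∂W∂ᵀ : ∀ {n} → (Subset n → Bool) → (Subset n → Carrier) → ℕ → Subset n → Subset n → Carrier
  ∂W∂ᵀ X w m σ τ = sumL (faces X m) (λ ρ → bd σ ρ *ᶠ w ρ *ᶠ bd τ ρ)

  upLap′ : ∀ {n} → (Subset n → Bool) → (Subset n → Carrier) → ℕ → Subset n → Subset n → Carrier
  upLap′ X w k σ τ = invSqrt (w σ) *ᶠ ∂W∂ᵀ X w (suc k) σ τ *ᶠ invSqrt (w τ)

  ∂W∂ᵀ-above-dim : ∀ {n} (X : Subset n → Bool) w m (σ τ : Subset n) → dimPlusOne X < suc m → ∂W∂ᵀ X w m σ τ ≈ 0#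
  ∂W∂ᵀ-above-dim {n} X w m σ τ dim<1+m = ≈-trans (sumL-faces X m _) (Σˢ-zero n no-face)
    where
    no-face : ∀ ρ → [ X ρ ∧ (∣ ρ ∣ ≡ᵇ suc m) ]· (bd σ ρ *ᶠ w ρ *ᶠ bd τ ρ) ≈ 0#
    no-face ρ with X ρ ∧ (∣ ρ ∣ ≡ᵇ suc m) in ρ∈Xₘ
    ... | false = ≈-refl
    ... | true with ρ∈X , ∣ρ∣≡1+m ← ∧-true⁻ {X ρ} ρ∈Xₘ =
      ⊥-elim (ℕₚ.<⇒≱ dim<1+m (subst (_≤ dimPlusOne X) (≡ᵇ-true⇒≡ ∣ρ∣≡1+m) (face⇒∣∣≤dimPlusOne X ρ ρ∈X)))

  upLap≈upLap′ : ∀ {n} (X : Subset n → Bool) w k (σ τ : Subset n) → upLap X w k σ τ ≈ upLap′ X w k σ τ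
  upLap≈upLap′ X w k σ τ with suc (suc k) ≤ᵇ dimPlusOne X in below-dim
  ... | true  = ≈-refl
  ... | false = ≈-sym (*-zeroˡ-≈ _ (*-zeroʳ-≈ _ (∂W∂ᵀ-above-dim X w (suc k) σ τ dim<2+k)))
    where
    dim<2+k : dimPlusOne X < suc (suc k)
    dim<2+k = ℕₚ.≰⇒> (λ 2+k≤dim → subst T below-dim (ℕₚ.≤⇒≤ᵇ 2+k≤dim))

  link-coface-term : ∀ {n} (X : Subset n → Bool) (w : Subset n → Carrier) (m k : ℕ) (η σ τ : Subset n) →
                     m + ∣ η ∣ ≡ k → η ⊆ᵇ σ ≡ true → η ⊆ᵇ τ ≡ true → (ρ : Subset n) →
                     (sign (pairCount σ η) *ᶠ sign (pairCount τ η)) *ᶠ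
                       ([ η ⊆ᵇ ρ ]· ([ X ((ρ ─ η) ∪ η) ∧ (∣ ρ ─ η ∣ ≡ᵇ suc (suc m)) ]·
                                       (bd (σ ─ η) (ρ ─ η) *ᶠ w ((ρ ─ η) ∪ η) *ᶠ bd (τ ─ η) (ρ ─ η))))
                       ≈ [ X ρ ∧ (∣ ρ ∣ ≡ᵇ suc (suc k)) ]· (bd σ ρ *ᶠ w ρ *ᶠ bd τ ρ)
  link-coface-term X w m k η σ τ m+∣η∣≡k η⊆σ η⊆τ ρ with η ⊆ᵇ ρ in η⊆ρ
  ... | false = ≈-trans (zeroʳ _) (≈-sym (≈-trans ([]·-cong _ (*-zeroˡ-≈ _ (*-zeroˡ-≈ _ (≈-reflexive (bd-⊈ η σ ρ η⊆σ η⊆ρ)))))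
                                                  ([]·-zero _)))
  ... | true  = begin
    s *ᶠ ([ X ((ρ ─ η) ∪ η) ∧ (∣ ρ ─ η ∣ ≡ᵇ suc (suc m)) ]· term)
      ≡⟨ cong (λ b → s *ᶠ ([ b ]· term)) (cong₂ _∧_ (cong X ρ─η∪η≡ρ) ∣ρ─η∣≡2+m⇔∣ρ∣≡2+k) ⟩
    s *ᶠ ([ X ρ ∧ (∣ ρ ∣ ≡ᵇ suc (suc k)) ]· term)     ≈⟨ *-[]· _ s _ ⟩
    [ X ρ ∧ (∣ ρ ∣ ≡ᵇ suc (suc k)) ]· (s *ᶠ term)     ≈⟨ []·-cong _ (bd-─-product η σ τ ρ _ η⊆σ η⊆τ η⊆ρ) ⟩
    [ X ρ ∧ (∣ ρ ∣ ≡ᵇ suc (suc k)) ]· (bd σ ρ *ᶠ w ((ρ ─ η) ∪ η) *ᶠ bd τ ρ)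
      ≡⟨ cong (λ ρ′ → [ X ρ ∧ (∣ ρ ∣ ≡ᵇ suc (suc k)) ]· (bd σ ρ *ᶠ w ρ′ *ᶠ bd τ ρ)) ρ─η∪η≡ρ ⟩
    [ X ρ ∧ (∣ ρ ∣ ≡ᵇ suc (suc k)) ]· (bd σ ρ *ᶠ w ρ *ᶠ bd τ ρ) ∎
    where
    s = sign (pairCount σ η) *ᶠ sign (pairCount τ η)
    term = bd (σ ─ η) (ρ ─ η) *ᶠ w ((ρ ─ η) ∪ η) *ᶠ bd (τ ─ η) (ρ ─ η)
    ρ─η∪η≡ρ : (ρ ─ η) ∪ η ≡ ρ
    ρ─η∪η≡ρ = p─q∪q≡p ρ η η⊆ρ
    ∣ρ─η∣≡2+m⇔∣ρ∣≡2+k : (∣ ρ ─ η ∣ ≡ᵇ suc (suc m)) ≡ (∣ ρ ∣ ≡ᵇ suc (suc k))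
    ∣ρ─η∣≡2+m⇔∣ρ∣≡2+k = trans (∣─∣-≡ᵇ η ρ (suc (suc m)) η⊆ρ) (cong (λ j → ∣ ρ ∣ ≡ᵇ suc (suc j)) m+∣η∣≡k)

  ∂W∂ᵀ-link : ∀ {n} (X : Subset n → Bool) (w : Subset n → Carrier) (m k : ℕ) (η σ τ : Subset n) →
              m + ∣ η ∣ ≡ k → η ⊆ᵇ σ ≡ true → η ⊆ᵇ τ ≡ true →
              (sign (pairCount σ η) *ᶠ sign (pairCount τ η)) *ᶠ ∂W∂ᵀ (link X η) (λ ρ → w (ρ ∪ η)) (suc m) (σ ─ η) (τ ─ η)
                ≈ ∂W∂ᵀ X w (suc k) σ τ
  ∂W∂ᵀ-link {n} X w m k η σ τ m+∣η∣≡k η⊆σ η⊆τ = begin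
    s *ᶠ ∂W∂ᵀ (link X η) (λ ρ → w (ρ ∪ η)) (suc m) (σ ─ η) (τ ─ η)
      ≈⟨ *-cong ≈-refl (sumL-faces (link X η) (suc m) term) ⟩
    s *ᶠ Σˢ n (λ ρ → [ link X η ρ ∧ (∣ ρ ∣ ≡ᵇ suc (suc m)) ]· term ρ)
      ≈⟨ *-cong ≈-refl (Σˢ-cong n (λ ρ → ≈-reflexive
           (trans (cong ([_]· term ρ) (∧-assoc (∣ ρ ∩ η ∣ ≡ᵇ 0) _ _)) ([]·-∧ (∣ ρ ∩ η ∣ ≡ᵇ 0) _ (term ρ))))) ⟩
    s *ᶠ Σˢ n (λ ρ → [ ∣ ρ ∩ η ∣ ≡ᵇ 0 ]· ([ X (ρ ∪ η) ∧ (∣ ρ ∣ ≡ᵇ suc (suc m)) ]· term ρ))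
      ≈⟨ *-cong ≈-refl (Σˢ-disjoint≈Σˢ-⊇ n η _) ⟩
    s *ᶠ Σˢ n (λ ρ → [ η ⊆ᵇ ρ ]· ([ X ((ρ ─ η) ∪ η) ∧ (∣ ρ ─ η ∣ ≡ᵇ suc (suc m)) ]· term (ρ ─ η)))
      ≈⟨ sumL-*ˡ (allSubsets n) s _ ⟨
    Σˢ n (λ ρ → s *ᶠ ([ η ⊆ᵇ ρ ]· ([ X ((ρ ─ η) ∪ η) ∧ (∣ ρ ─ η ∣ ≡ᵇ suc (suc m)) ]· term (ρ ─ η))))
      ≈⟨ Σˢ-cong n (link-coface-term X w m k η σ τ m+∣η∣≡k η⊆σ η⊆τ) ⟩
    Σˢ n (λ ρ → [ X ρ ∧ (∣ ρ ∣ ≡ᵇ suc (suc k)) ]· (bd σ ρ *ᶠ w ρ *ᶠ bd τ ρ))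
      ≈⟨ sumL-faces X (suc k) _ ⟨
    ∂W∂ᵀ X w (suc k) σ τ ∎
    where
    s = sign (pairCount σ η) *ᶠ sign (pairCount τ η)
    term : Subset n → Carrier
    term ρ = bd (σ ─ η) ρ *ᶠ w (ρ ∪ η) *ᶠ bd (τ ─ η) ρ

  Rmat-diagonal : ∀ {n} (X : Subset n → Bool) w (σ : Subset n) →
                  Rmat X w σ σ ≡ sumL (filterᵇ (λ v → not (lookup σ v) ∧ X (σ ∪ ⁅ v ⁆)) (allFin n)) (λ v → w (σ ∪ ⁅ v ⁆) *ᶠ inv (w σ))
  Rmat-diagonal X w σ rewrite dec-true (≡-dec Bool._≟_ σ σ) refl = refl

  Rmat-off-diagonal : ∀ {n} (X : Subset n → Bool) w (σ τ : Subset n) → σ ≢ τ → Rmat X w σ τ ≡ 0#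
  Rmat-off-diagonal X w σ τ σ≢τ rewrite dec-false (≡-dec Bool._≟_ σ τ) σ≢τ = refl

  ∂W∂ᵀ-diagonal : ∀ {n} (X : Subset n → Bool) w k (σ : Subset n) → ∣ σ ∣ ≡ suc k →
                  ∂W∂ᵀ X w (suc k) σ σ ≈ sumL (allFin n) (λ v → [ not (lookup σ v) ∧ X (σ ∪ ⁅ v ⁆) ]· w (σ ∪ ⁅ v ⁆))
  ∂W∂ᵀ-diagonal {n} X w k σ ∣σ∣≡1+k = begin
    ∂W∂ᵀ X w (suc k) σ σ
      ≈⟨ sumL-faces X (suc k) _ ⟩
    Σˢ n (λ ρ → [ X ρ ∧ (∣ ρ ∣ ≡ᵇ suc (suc k)) ]· (bd σ ρ *ᶠ w ρ *ᶠ bd σ ρ))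
      ≈⟨ Σˢ-cong n (λ ρ → cofacet-term ρ (isFacet σ ρ) refl) ⟩
    Σˢ n (λ ρ → [ isFacet σ ρ ]· ([ X ρ ]· w ρ))
      ≈⟨ Σˢ-cofacets n σ (λ ρ → [ X ρ ]· w ρ) ⟩
    sumL (allFin n) (λ v → [ not (lookup σ v) ]· ([ X (σ ∪ ⁅ v ⁆) ]· w (σ ∪ ⁅ v ⁆)))
      ≈⟨ sumL-cong (allFin n) (λ v → ≈-reflexive ([]·-∧ (not (lookup σ v)) _ _)) ⟨
    sumL (allFin n) (λ v → [ not (lookup σ v) ∧ X (σ ∪ ⁅ v ⁆) ]· w (σ ∪ ⁅ v ⁆)) ∎
    where
    cofacet-term : ∀ ρ b → isFacet σ ρ ≡ b →
                   [ X ρ ∧ (∣ ρ ∣ ≡ᵇ suc (suc k)) ]· (bd σ ρ *ᶠ w ρ *ᶠ bd σ ρ) ≈ [ b ]· ([ X ρ ]· w ρ)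
    cofacet-term ρ false σ⋖̸ρ =
      ≈-trans ([]·-cong _ (*-zeroˡ-≈ _ (*-zeroˡ-≈ _ (≈-reflexive (bd-nonfacet σ ρ σ⋖̸ρ))))) ([]·-zero _)
    cofacet-term ρ true  σ⋖ρ = begin
      [ X ρ ∧ (∣ ρ ∣ ≡ᵇ suc (suc k)) ]· (bd σ ρ *ᶠ w ρ *ᶠ bd σ ρ)
        ≡⟨ cong (λ b → [ X ρ ∧ b ]· (bd σ ρ *ᶠ w ρ *ᶠ bd σ ρ)) (≡⇒≡ᵇ-true (trans (isFacet⇒∣∣≡suc σ ρ σ⋖ρ) (cong suc ∣σ∣≡1+k))) ⟩
      [ X ρ ∧ true ]· (bd σ ρ *ᶠ w ρ *ᶠ bd σ ρ)   ≡⟨ cong (λ b → [ b ]· (bd σ ρ *ᶠ w ρ *ᶠ bd σ ρ)) (∧-identityʳ (X ρ)) ⟩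
      [ X ρ ]· (bd σ ρ *ᶠ w ρ *ᶠ bd σ ρ)          ≡⟨ cong (λ x → [ X ρ ]· (x *ᶠ w ρ *ᶠ x)) (bd-facet σ ρ σ⋖ρ) ⟩
      [ X ρ ]· (s *ᶠ w ρ *ᶠ s)                    ≈⟨ []·-cong (X ρ) (xy∙z≈y∙xz s (w ρ) s) ⟩
      [ X ρ ]· (w ρ *ᶠ (s *ᶠ s))                  ≈⟨ []·-cong (X ρ) (*-cong ≈-refl (sign²≈1 (bdExp σ ρ))) ⟩
      [ X ρ ]· (w ρ *ᶠ 1#)                        ≈⟨ []·-cong (X ρ) (*-identityʳ (w ρ)) ⟩
      [ X ρ ]· w ρ                                ∎
      where
      s = sign (bdExp σ ρ)

  upLap′-diagonal : ∀ {n} (X : Subset n → Bool) w k (σ : Subset n) → ∣ σ ∣ ≡ suc k → 0# <ᶠ w σ →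
                    upLap′ X w k σ σ ≈ Rmat X w σ σ
  upLap′-diagonal {n} X w k σ ∣σ∣≡1+k wσ>0 = begin
    a *ᶠ ∂W∂ᵀ X w (suc k) σ σ *ᶠ a                                     ≈⟨ xy∙z≈xz∙y a _ a ⟩
    a *ᶠ a *ᶠ ∂W∂ᵀ X w (suc k) σ σ                                     ≈⟨ *-cong (invSqrt²≈inv (w σ) wσ>0) (∂W∂ᵀ-diagonal X w k σ ∣σ∣≡1+k) ⟩
    inv (w σ) *ᶠ sumL (allFin n) (λ v → [ cofacet v ]· w (σ ∪ ⁅ v ⁆))    ≈⟨ sumL-*ˡ (allFin n) (inv (w σ)) _ ⟨
    sumL (allFin n) (λ v → inv (w σ) *ᶠ ([ cofacet v ]· w (σ ∪ ⁅ v ⁆)))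
      ≈⟨ sumL-cong (allFin n) (λ v → ≈-trans (*-[]· (cofacet v) _ _) ([]·-cong (cofacet v) (*-comm _ _))) ⟩
    sumL (allFin n) (λ v → [ cofacet v ]· (w (σ ∪ ⁅ v ⁆) *ᶠ inv (w σ)))  ≈⟨ sumL-filterᵇ cofacet (allFin n) _ ⟨
    sumL (filterᵇ cofacet (allFin n)) (λ v → w (σ ∪ ⁅ v ⁆) *ᶠ inv (w σ)) ≡⟨ Rmat-diagonal X w σ ⟨
    Rmat X w σ σ                                                       ∎
    where
    a = invSqrt (w σ)
    cofacet : Fin n → Bool
    cofacet v = not (lookup σ v) ∧ X (σ ∪ ⁅ v ⁆)

  upLap′-nonadjacent : ∀ {n} (X : Subset n → Bool) w k (σ τ : Subset n) → σ ≢ τ → ∣ σ ∣ ≡ suc k → ∣ σ ∩ τ ∣ ≢ k →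
                       upLap′ X w k σ τ ≈ 0#
  upLap′-nonadjacent X w k σ τ σ≢τ ∣σ∣≡1+k ∣σ∩τ∣≢k =
    *-zeroˡ-≈ _ (*-zeroʳ-≈ _ (sumL-zero (faces X (suc k)) (λ ρ → no-common-coface ρ (isFacet σ ρ) (isFacet τ ρ) refl refl)))
    where
    no-common-coface : ∀ ρ b c → isFacet σ ρ ≡ b → isFacet τ ρ ≡ c → bd σ ρ *ᶠ w ρ *ᶠ bd τ ρ ≈ 0#
    no-common-coface ρ false _     σ⋖̸ρ _   = *-zeroˡ-≈ _ (*-zeroˡ-≈ _ (≈-reflexive (bd-nonfacet σ ρ σ⋖̸ρ)))
    no-common-coface ρ true  false _   τ⋖̸ρ = *-zeroʳ-≈ _ (≈-reflexive (bd-nonfacet τ ρ τ⋖̸ρ))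
    no-common-coface ρ true  true  σ⋖ρ τ⋖ρ =
      ⊥-elim (∣σ∩τ∣≢k (ℕₚ.suc-injective (trans (distinct-facets-∣∩∣ σ τ ρ σ⋖ρ τ⋖ρ σ≢τ) ∣σ∣≡1+k)))

  lhs43-term : ∀ {n} (X : Subset n → Bool) w (k ℓ : ℕ) (η σ τ : Subset n) → ℓ < k → ∣ η ∣ ≡ suc ℓ →
               η ⊆ᵇ σ ≡ true → η ⊆ᵇ τ ≡ true →
               sη k ℓ η σ *ᶠ sη k ℓ η τ *ᶠ ⟦ suc k ⟧ *ᶠ Lη X w k ℓ η σ τ
                 ≈ (inv ⟦ suc k C suc ℓ ⟧ *ᶠ ⟦ suc k ⟧) *ᶠ upLap′ X w k σ τ
  lhs43-term X w k ℓ η σ τ ℓ<k ∣η∣≡1+ℓ η⊆σ η⊆τ = begin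
    (i *ᶠ sσ) *ᶠ (i *ᶠ sτ) *ᶠ ⟦ suc k ⟧ *ᶠ Lη X w k ℓ η σ τ
      ≈⟨ *-cong ≈-refl Lη≈ ⟩
    (i *ᶠ sσ) *ᶠ (i *ᶠ sτ) *ᶠ ⟦ suc k ⟧ *ᶠ (a *ᶠ D *ᶠ b)
      ≈⟨ Solver.solve 7 (λ i s t n a d b → (i :* s) :* (i :* t) :* n :* (a :* d :* b) := i :* i :* n :* (a :* (s :* t :* d) :* b))
                        ≈-refl i sσ sτ ⟦ suc k ⟧ a D b ⟩
    i *ᶠ i *ᶠ ⟦ suc k ⟧ *ᶠ (a *ᶠ (sσ *ᶠ sτ *ᶠ D) *ᶠ b)
      ≈⟨ *-cong (*-cong (invSqrt²≈inv _ (⟦⟧>0 (nCk>0 (suc k) (suc ℓ) (ℕₚ.m≤n⇒m≤1+n ℓ<k)))) ≈-refl)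
                (*-cong (*-cong ≈-refl (∂W∂ᵀ-link X w (k ∸ ℓ ∸ 1) k η σ τ m+∣η∣≡k η⊆σ η⊆τ)) ≈-refl) ⟩
    inv ⟦ suc k C suc ℓ ⟧ *ᶠ ⟦ suc k ⟧ *ᶠ upLap′ X w k σ τ ∎
    where
    open Solver using (_:*_; _:=_)
    i = invSqrt ⟦ suc k C suc ℓ ⟧
    sσ = sign (pairCount σ η)
    sτ = sign (pairCount τ η)
    a = invSqrt (w σ)
    b = invSqrt (w τ)
    D = ∂W∂ᵀ (link X η) (λ ρ → w (ρ ∪ η)) (suc (k ∸ ℓ ∸ 1)) (σ ─ η) (τ ─ η)
    Lη≈ : Lη X w k ℓ η σ τ ≈ a *ᶠ D *ᶠ b
    Lη≈ = ≈-trans (upLap≈upLap′ (link X η) (λ ρ → w (ρ ∪ η)) (k ∸ ℓ ∸ 1) (σ ─ η) (τ ─ η))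
                  (≈-reflexive (cong₂ (λ σ′ τ′ → invSqrt (w σ′) *ᶠ D *ᶠ invSqrt (w τ′)) (p─q∪q≡p σ η η⊆σ) (p─q∪q≡p τ η η⊆τ)))
    m+∣η∣≡k : k ∸ ℓ ∸ 1 + ∣ η ∣ ≡ k
    m+∣η∣≡k = trans (cong₂ _+_ (trans (ℕₚ.∸-+-assoc k ℓ 1) (cong (k ∸_) (ℕₚ.+-comm ℓ 1))) ∣η∣≡1+ℓ) (ℕₚ.m∸n+n≡m ℓ<k)

  lhs43-closed-form : ∀ {n} (X : SimplicialComplex n) w (k ℓ : ℕ) (σ τ : Subset n) → ℓ < k → face X σ ≡ true →
           lhs43 (face X) w k ℓ σ τ ≈ ⟦ ∣ σ ∩ τ ∣ C suc ℓ ⟧ *ᶠ ((inv ⟦ suc k C suc ℓ ⟧ *ᶠ ⟦ suc k ⟧) *ᶠ upLap′ (face X) w k σ τ)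
  lhs43-closed-form {n} X w k ℓ σ τ ℓ<k σ∈X = begin
    lhs43 (face X) w k ℓ σ τ                                                  ≈⟨ sumL-filterᵇ below-στ (faces (face X) ℓ) term ⟩
    sumL (faces (face X) ℓ) (λ η → [ below-στ η ]· term η)                    ≈⟨ sumL-faces (face X) ℓ _ ⟩
    Σˢ n (λ η → [ face X η ∧ (∣ η ∣ ≡ᵇ suc ℓ) ]· ([ below-στ η ]· term η))    ≈⟨ Σˢ-cong n restrict ⟩
    Σˢ n (λ η → [ (∣ η ∣ ≡ᵇ suc ℓ) ∧ (η ⊆ᵇ (σ ∩ τ)) ]· (r *ᶠ U))             ≈⟨ Σˢ-subsets-of-size n (σ ∩ τ) (suc ℓ) _ ⟩
    ⟦ ∣ σ ∩ τ ∣ C suc ℓ ⟧ *ᶠ (r *ᶠ U)                                         ∎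
    where
    r = inv ⟦ suc k C suc ℓ ⟧ *ᶠ ⟦ suc k ⟧
    U = upLap′ (face X) w k σ τ
    below-στ : Subset n → Bool
    below-στ η = (η ⊆ᵇ σ) ∧ (η ⊆ᵇ τ)
    term : Subset n → Carrier
    term η = sη k ℓ η σ *ᶠ sη k ℓ η τ *ᶠ ⟦ suc k ⟧ *ᶠ Lη (face X) w k ℓ η σ τ
    restrict : ∀ η → [ face X η ∧ (∣ η ∣ ≡ᵇ suc ℓ) ]· ([ below-στ η ]· term η) ≈ [ (∣ η ∣ ≡ᵇ suc ℓ) ∧ (η ⊆ᵇ (σ ∩ τ)) ]· (r *ᶠ U)
    restrict η = ≈-trans ([]·-restrict (face X η) (∣ η ∣ ≡ᵇ suc ℓ) (below-στ η) η∈X term≈)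
                         (≈-reflexive (cong (λ b → [ (∣ η ∣ ≡ᵇ suc ℓ) ∧ b ]· (r *ᶠ U)) (sym (⊆ᵇ-∩ η σ τ))))
      where
      η∈X : below-στ η ≡ true → face X η ≡ true
      η∈X η⊆στ with η⊆σ , _ ← ∧-true⁻ {η ⊆ᵇ σ} η⊆στ = down-closed X η σ (⊆ᵇ⇒⊆ η σ η⊆σ) σ∈X
      term≈ : (∣ η ∣ ≡ᵇ suc ℓ) ≡ true → below-στ η ≡ true → term η ≈ r *ᶠ U
      term≈ ∣η∣≡1+ℓ η⊆στ with η⊆σ , η⊆τ ← ∧-true⁻ {η ⊆ᵇ σ} η⊆στ =
        lhs43-term (face X) w k ℓ η σ τ ℓ<k (≡ᵇ-true⇒≡ ∣η∣≡1+ℓ) η⊆σ η⊆τ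

  lhs43≈rhs43-diagonal : ∀ {n} (X : SimplicialComplex n) w (k ℓ : ℕ) (σ τ : Subset n) → ℓ < k →
                         face X σ ≡ true → ∣ σ ∣ ≡ suc k → 0# <ᶠ w σ → σ ≡ τ →
                         lhs43 (face X) w k ℓ σ τ ≈ rhs43 (face X) w k ℓ σ τ
  lhs43≈rhs43-diagonal X w k ℓ σ _ ℓ<k σ∈X ∣σ∣≡1+k wσ>0 refl = begin
    lhs43 (face X) w k ℓ σ σ                    ≈⟨ lhs43-closed-form X w k ℓ σ σ ℓ<k σ∈X ⟩
    ⟦ ∣ σ ∩ σ ∣ C suc ℓ ⟧ *ᶠ (r *ᶠ U)           ≡⟨ cong (λ j → ⟦ j C suc ℓ ⟧ *ᶠ (r *ᶠ U)) (trans (cong ∣_∣ (∩-idem σ)) ∣σ∣≡1+k) ⟩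
    ⟦ suc k C suc ℓ ⟧ *ᶠ (r *ᶠ U)               ≈⟨ *-assoc _ r U ⟨
    (⟦ suc k C suc ℓ ⟧ *ᶠ r) *ᶠ U               ≈⟨ *-cong (⟦⟧-ratio _ (suc k) _ (suc k) C>0 refl) ≈-refl ⟩
    ⟦ suc k ⟧ *ᶠ U                              ≡⟨ cong (λ j → ⟦ j ⟧ *ᶠ U) k∸ℓ+[1+ℓ]≡1+k ⟨
    ⟦ k ∸ ℓ + suc ℓ ⟧ *ᶠ U                      ≈⟨ *-cong (⟦⟧-+ (k ∸ ℓ) (suc ℓ)) ≈-refl ⟩
    (⟦ k ∸ ℓ ⟧ +ᶠ ⟦ suc ℓ ⟧) *ᶠ U               ≈⟨ distribʳ U _ _ ⟩
    ⟦ k ∸ ℓ ⟧ *ᶠ U +ᶠ ⟦ suc ℓ ⟧ *ᶠ U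
      ≈⟨ +-cong (*-cong ≈-refl (≈-sym (upLap≈upLap′ (face X) w k σ σ))) (*-cong ≈-refl (upLap′-diagonal (face X) w k σ ∣σ∣≡1+k wσ>0)) ⟩
    rhs43 (face X) w k ℓ σ σ                    ∎
    where
    r = inv ⟦ suc k C suc ℓ ⟧ *ᶠ ⟦ suc k ⟧
    U = upLap′ (face X) w k σ σ
    C>0 = nCk>0 (suc k) (suc ℓ) (ℕₚ.m≤n⇒m≤1+n ℓ<k)
    k∸ℓ+[1+ℓ]≡1+k : k ∸ ℓ + suc ℓ ≡ suc k
    k∸ℓ+[1+ℓ]≡1+k = trans (ℕₚ.+-suc (k ∸ ℓ) ℓ) (cong suc (ℕₚ.m∸n+n≡m (ℕₚ.<⇒≤ ℓ<k)))

  lhs43≈rhs43-adjacent : ∀ {n} (X : SimplicialComplex n) w (k ℓ : ℕ) (σ τ : Subset n) → ℓ < k →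
                         face X σ ≡ true → σ ≢ τ → ∣ σ ∩ τ ∣ ≡ k →
                         lhs43 (face X) w k ℓ σ τ ≈ rhs43 (face X) w k ℓ σ τ
  lhs43≈rhs43-adjacent X w k ℓ σ τ ℓ<k σ∈X σ≢τ ∣σ∩τ∣≡k = begin
    lhs43 (face X) w k ℓ σ τ                    ≈⟨ lhs43-closed-form X w k ℓ σ τ ℓ<k σ∈X ⟩
    ⟦ ∣ σ ∩ τ ∣ C suc ℓ ⟧ *ᶠ (r *ᶠ U)           ≡⟨ cong (λ j → ⟦ j C suc ℓ ⟧ *ᶠ (r *ᶠ U)) ∣σ∩τ∣≡k ⟩
    ⟦ k C suc ℓ ⟧ *ᶠ (r *ᶠ U)                   ≈⟨ *-assoc _ r U ⟨
    (⟦ k C suc ℓ ⟧ *ᶠ r) *ᶠ U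
      ≈⟨ *-cong (⟦⟧-ratio _ (k ∸ ℓ) _ (suc k) C>0 ([1+n]*nC[1+k]≡[n∸k]*[1+n]C[1+k] k ℓ (ℕₚ.<⇒≤ ℓ<k))) ≈-refl ⟩
    ⟦ k ∸ ℓ ⟧ *ᶠ U                              ≈⟨ +-identityʳ _ ⟨
    ⟦ k ∸ ℓ ⟧ *ᶠ U +ᶠ 0#
      ≈⟨ +-cong (*-cong ≈-refl (≈-sym (upLap≈upLap′ (face X) w k σ τ)))
                (≈-sym (*-zeroʳ-≈ _ (≈-reflexive (Rmat-off-diagonal (face X) w σ τ σ≢τ)))) ⟩
    rhs43 (face X) w k ℓ σ τ                    ∎
    where
    r = inv ⟦ suc k C suc ℓ ⟧ *ᶠ ⟦ suc k ⟧
    U = upLap′ (face X) w k σ τ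
    C>0 = nCk>0 (suc k) (suc ℓ) (ℕₚ.m≤n⇒m≤1+n ℓ<k)

  lhs43≈rhs43-nonadjacent : ∀ {n} (X : SimplicialComplex n) w (k ℓ : ℕ) (σ τ : Subset n) → ℓ < k →
                            face X σ ≡ true → ∣ σ ∣ ≡ suc k → σ ≢ τ → ∣ σ ∩ τ ∣ ≢ k →
                            lhs43 (face X) w k ℓ σ τ ≈ rhs43 (face X) w k ℓ σ τ
  lhs43≈rhs43-nonadjacent X w k ℓ σ τ ℓ<k σ∈X ∣σ∣≡1+k σ≢τ ∣σ∩τ∣≢k = begin
    lhs43 (face X) w k ℓ σ τ                    ≈⟨ lhs43-closed-form X w k ℓ σ τ ℓ<k σ∈X ⟩
    ⟦ ∣ σ ∩ τ ∣ C suc ℓ ⟧ *ᶠ (r *ᶠ U)           ≈⟨ *-zeroʳ-≈ _ (*-zeroʳ-≈ r U≈0) ⟩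
    0#                                          ≈⟨ +-identityʳ 0# ⟨
    0# +ᶠ 0#
      ≈⟨ +-cong (≈-sym (*-zeroʳ-≈ _ (≈-trans (upLap≈upLap′ (face X) w k σ τ) U≈0)))
                (≈-sym (*-zeroʳ-≈ _ (≈-reflexive (Rmat-off-diagonal (face X) w σ τ σ≢τ)))) ⟩
    rhs43 (face X) w k ℓ σ τ                    ∎
    where
    r = inv ⟦ suc k C suc ℓ ⟧ *ᶠ ⟦ suc k ⟧
    U = upLap′ (face X) w k σ τ
    U≈0 = upLap′-nonadjacent (face X) w k σ τ σ≢τ ∣σ∣≡1+k ∣σ∩τ∣≢k

proposition4p3 : ∀ {c ℓ₁ ℓ₂} (F : SqrtOrderedField c ℓ₁ ℓ₂) →
    let open SqrtOrderedField F
        open Laplacians F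
    in ∀ {n} (X : SimplicialComplex n) (w : Subset n → Carrier) →
       (∀ σ → face X σ ≡ true → 0# <ᶠ w σ) →
       (ℓ k : ℕ) → ℓ < k → suc k ≤ dimPlusOne (face X) →
       (σ τ : Subset n) →
       face X σ ≡ true → ∣ σ ∣ ≡ suc k →
       face X τ ≡ true → ∣ τ ∣ ≡ suc k →
       lhs43 (face X) w k ℓ σ τ ≈ rhs43 (face X) w k ℓ σ τ
proposition4p3 F X w w>0 ℓ k ℓ<k _ σ τ σ∈X ∣σ∣≡1+k _ _ = by-cases (σ ≟ˢ τ) (∣ σ ∩ τ ∣ ℕ.≟ k)
  where
  open SqrtOrderedField F using (_≈_)
  open Laplacians F using (lhs43; rhs43)
  by-cases : Dec (σ ≡ τ) → Dec (∣ σ ∩ τ ∣ ≡ k) → lhs43 (face X) w k ℓ σ τ ≈ rhs43 (face X) w k ℓ σ τ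
  by-cases (yes σ≡τ) _             = lhs43≈rhs43-diagonal F X w k ℓ σ τ ℓ<k σ∈X ∣σ∣≡1+k (w>0 σ σ∈X) σ≡τ
  by-cases (no σ≢τ)  (yes ∣σ∩τ∣≡k) = lhs43≈rhs43-adjacent F X w k ℓ σ τ ℓ<k σ∈X σ≢τ ∣σ∩τ∣≡k
  by-cases (no σ≢τ)  (no ∣σ∩τ∣≢k)  = lhs43≈rhs43-nonadjacent F X w k ℓ σ τ ℓ<k σ∈X ∣σ∣≡1+k σ≢τ ∣σ∩τ∣≢k
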